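{- Let $P$ be a finite poset. For every $k=0,1,\dots,\#P$, the distribution $\mathrm{chain}(k)$ on $J(P)$ is toggle-symmetric.
   Context: $J(P)$ is the set of order ideals of $P$ ordered by inclusion; its longest chains have length $\#P$. $\mathrm{chain}(k)$ on $J(P)$ gives $I$ probability $\#\{k\text{ -chains } c_0\subsetneq\dots\subsetneq c_k \text{ of } J(P) \text{ with } I=c_i \text{ for some } i\}/((k+1)\#\{k\text{ -chains of } J(P)\})$. For $I\in J(P)$, $p\in P$: $\mathcal{T}^+_p(I)=1$ if $p\notin I$ and $p$ is minimal in $P\setminus I$, else 0; $\mathcal{T}^-_p(I)=1$ if $p\in I$ and $p$ is maximal in $I$, else 0. A distribution $\mu$ on $J(P)$ is toggle-symmetric if $\mathbb{E}(\mu;\mathcal{T}^+_p)=\mathbb{E}(\mu;\mathcal{T}^-_p)$ for all $p\in P$. -}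

module Defs where

open import Level using (0ℓ)
open import Data.Nat using (ℕ; zero; suc; _*_)
open import Data.Bool using (Bool; true; false; _∧_; _∨_; not; if_then_else_)
open import Data.Fin using (Fin; _≟_)
open import Data.Vec using (Vec; []; _∷_; lookup; head; toList)
open import Data.Vec.Properties using (≡-dec)
import Data.Bool.Properties as BoolP
open import Data.List using (List; []; _∷_; map; concatMap; filterᵇ; allFin; length; foldr)
open import Data.Bool.ListAction using (all; any)
open import Data.Integer using (+_)
open import Data.Rational using (ℚ; 0ℚ; 1ℚ; _/_) renaming (_+_ to _+ℚ_; _*_ to _*ℚ_)
open import Relation.Binary using (Rel; IsDecPartialOrder)
open import Relation.Binary.PropositionalEquality using (_≡_)
open import Relation.Nullary.Decidable using (⌊_⌋)

record FinPoset : Set₁ where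
  field
    n   : ℕ
    _≼_ : Rel (Fin n) 0ℓ
    isDecPartialOrder : IsDecPartialOrder _≡_ _≼_
  open IsDecPartialOrder isDecPartialOrder public using (_≤?_)

Subset : ℕ → Set
Subset n = Vec Bool n

allSubsets : (n : ℕ) → List (Subset n)
allSubsets zero = [] ∷ []
allSubsets (suc n) = concatMap (λ s → (false ∷ s) ∷ (true ∷ s) ∷ []) (allSubsets n)

_==ˢ_ : ∀ {n} → Subset n → Subset n → Bool
I ==ˢ J = ⌊ ≡-dec BoolP._≟_ I J ⌋

_⊊ᵇ_ : ∀ {n} → Subset n → Subset n → Bool
_⊊ᵇ_ {n} I J = all (λ x → not (lookup I x) ∨ lookup J x) (allFin n)
             ∧ any (λ x → lookup J x ∧ not (lookup I x)) (allFin n)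

module _ (P : FinPoset) where
  open FinPoset P

  le : Fin n → Fin n → Bool
  le x y = ⌊ x ≤? y ⌋

  eqF : Fin n → Fin n → Bool
  eqF x y = ⌊ x ≟ y ⌋

  isIdeal : Subset n → Bool
  isIdeal I = all (λ x → all (λ y → not (le y x ∧ lookup I x) ∨ lookup I y) (allFin n)) (allFin n)

  J : List (Subset n)
  J = filterᵇ isIdeal (allSubsets n)

  -- k-chains c_0 ⊊ c_1 ⊊ ... ⊊ c_k of J(P), stored as (c_0, ..., c_k)
  chains : (k : ℕ) → List (Vec (Subset n) (suc k))
  chains zero = map (λ I → I ∷ []) J
  chains (suc k) = concatMap (λ c → map (λ I → I ∷ c) (filterᵇ (λ I → I ⊊ᵇ head c) J)) (chains k)

  chainsThrough : ℕ → Subset n → ℕ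
  chainsThrough k I = length (filterᵇ (λ c → any (λ K → K ==ˢ I) (toList c)) (chains k))

  -- a / b in ℚ (junk value 0 when b = 0)
  frac : ℕ → ℕ → ℚ
  frac a zero = 0ℚ
  frac a (suc b) = (+ a) / suc b

  chainDist : ℕ → Subset n → ℚ
  chainDist k I = frac (chainsThrough k I) (suc k * length (chains k))

  expect : (Subset n → ℚ) → (Subset n → Bool) → ℚ
  expect μ f = foldr (λ I acc → μ I *ℚ (if f I then 1ℚ else 0ℚ) +ℚ acc) 0ℚ J

  togglePlus : Fin n → Subset n → Bool
  togglePlus p I = not (lookup I p)
    ∧ all (λ q → not (le q p ∧ not (eqF q p) ∧ not (lookup I q))) (allFin n)

  toggleMinus : Fin n → Subset n → Bool
  toggleMinus p I = lookup I p
    ∧ all (λ q → not (le p q ∧ not (eqF q p) ∧ lookup I q)) (allFin n)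

  ToggleSymmetric : (Subset n → ℚ) → Set
  ToggleSymmetric μ = (p : Fin n) → expect μ (togglePlus p) ≡ expect μ (toggleMinus p)

-- Encode a k-chain c₀ ⊊ ⋯ ⊊ c_k of order ideals by f x = #{i | x ∉ cᵢ}: an order-preserving
-- map P → {0, …, k+1} attaining every value 1, …, k, with c_t = {x | f x ≤ t}. Then p is a
-- minimal non-element of c_t for exactly f p ∸ m indices t, and a maximal element of c_t for
-- exactly M ∸ f p indices t, where m = max {f q | q < p} and M = min ({k+1} ∪ {f q | q > p}).
-- Sum over f by first fixing f away from p. If f attains every value 1, …, k away from p, then
-- f p ranges over [m, M], and Σ (v ∸ m) = Σ (M ∸ v) there. Otherwise exactly one value w is
-- missed away from p and f p = w is forced; deleting the value w turns these f into pairs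
-- (w, h) with h of the first kind and m < w ≤ M, and Σ (w ∸ m) = Σ (M + 1 ∸ w) over (m, M].

module Submission where

open import Defs
open import Data.Bool using (Bool; true; false; T; not; _∧_; _∨_; if_then_else_)
import Data.Bool.Properties as Bool
open import Data.Bool.ListAction using (all; any)
open import Data.Empty using (⊥-elim)
open import Data.Fin as Fin using (Fin; zero; suc; toℕ)
import Data.Integer as ℤ
import Data.Integer.Properties as ℤ
open import Data.List using (List; []; _∷_; _++_; map; concatMap; filterᵇ; length; foldr; allFin; null)
open import Data.List.Properties using (∷-injectiveˡ; ∷-injectiveʳ)
open import Data.List.Membership.Propositional using (_∈_; find; lose)
open import Data.List.Membership.Propositional.Properties using (∈-allFin)
open import Data.List.Relation.Unary.All as All using (All; []; _∷_)
import Data.List.Relation.Unary.All.Properties as All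
open import Data.List.Relation.Unary.Any as Any using (here; there)
import Data.List.Relation.Unary.Any.Properties as Any
open import Data.Nat
open import Data.Nat.Properties
open import Algebra.Properties.CommutativeSemigroup +-commutativeSemigroup using (interchange)
open import Data.Product using (_×_; _,_; proj₁; proj₂; ∃)
open import Data.Rational as ℚ using (0ℚ; 1ℚ)
import Data.Rational.Properties as ℚₚ
open import Data.Rational.Unnormalised as ℚᵘ using (mkℚᵘ; *≡*)
import Data.Rational.Unnormalised.Properties as ℚᵘₚ
open import Data.Sum as Sum using (_⊎_; inj₁; inj₂)
open import Data.Unit using (tt)
open import Data.Vec using (Vec; []; _∷_; lookup; head; toList; tabulate; _[_]≔_)
import Data.Vec as Vec
open import Data.Vec.Properties using (≡-dec; lookup-map; lookup∘tabulate; tabulate∘lookup; tabulate-cong; lookup∘updateAt; lookup∘updateAt′)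
open import Function using (_∘_; const; Equivalence)
open import Relation.Binary using (DecidableEquality)
open import Relation.Binary.PropositionalEquality hiding (J)
open import Relation.Nullary using (yes; no; ¬_)
open import Relation.Nullary.Decidable using (⌊_⌋; toWitness; fromWitness; T?)

𝟙 : Bool → ℕ
𝟙 true = 1
𝟙 false = 0

𝟙≤1 : ∀ b → 𝟙 b ≤ 1
𝟙≤1 true = s≤s z≤n
𝟙≤1 false = z≤n

T⇔⇒≡ : ∀ {a b} → (T a → T b) → (T b → T a) → a ≡ b
T⇔⇒≡ {true} {true} _ _ = refl
T⇔⇒≡ {true} {false} f _ = ⊥-elim (f tt)
T⇔⇒≡ {false} {true} _ g = ⊥-elim (g tt)
T⇔⇒≡ {false} {false} _ _ = refl

T∧ : ∀ {a b} → T a → T b → T (a ∧ b)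
T∧ {a} {b} x y = Equivalence.from (Bool.T-∧ {a} {b}) (x , y)

T∧₁ : ∀ {a b} → T (a ∧ b) → T a
T∧₁ {a} {b} = proj₁ ∘ Equivalence.to (Bool.T-∧ {a} {b})

T∧₂ : ∀ {a b} → T (a ∧ b) → T b
T∧₂ {a} {b} = proj₂ ∘ Equivalence.to (Bool.T-∧ {a} {b})

T∨⁻ : ∀ {a b} → T (a ∨ b) → T a ⊎ T b
T∨⁻ {a} {b} = Equivalence.to (Bool.T-∨ {a} {b})

T∨₁ : ∀ {a b} → T a → T (a ∨ b)
T∨₁ {a} {b} = Equivalence.from (Bool.T-∨ {a} {b}) ∘ inj₁

T∨₂ : ∀ {a b} → T b → T (a ∨ b)
T∨₂ {a} {b} = Equivalence.from (Bool.T-∨ {a} {b}) ∘ inj₂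

Tnot : ∀ {a} → ¬ T a → T (not a)
Tnot {true} f = f tt
Tnot {false} f = tt

Tnot⁻ : ∀ {a} → T (not a) → ¬ T a
Tnot⁻ {true} () _

T→≡ : ∀ {a} → T a → a ≡ true
T→≡ {a} = Equivalence.to (Bool.T-≡ {a})

≡→T : ∀ {a} → a ≡ true → T a
≡→T {a} = Equivalence.from (Bool.T-≡ {a})

¬T→≡ : ∀ {a} → ¬ T a → a ≡ false
¬T→≡ {true} f = ⊥-elim (f tt)
¬T→≡ {false} _ = refl

𝟙-¬T : ∀ {a} → ¬ T a → 𝟙 a ≡ 0
𝟙-¬T {a} f = cong 𝟙 (¬T→≡ f)

𝟙-∧ : ∀ a b → 𝟙 (a ∧ b) ≡ 𝟙 a * 𝟙 b
𝟙-∧ true b = sym (+-identityʳ (𝟙 b))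
𝟙-∧ false b = refl

𝟙-∧-* : ∀ a b y → 𝟙 (a ∧ b) * y ≡ 𝟙 a * (𝟙 b * y)
𝟙-∧-* a b y = trans (cong (_* y) (𝟙-∧ a b)) (*-assoc (𝟙 a) (𝟙 b) y)

all-allFin⁻ : ∀ {n} (g : Fin n → Bool) → T (all g (allFin n)) → ∀ x → T (g x)
all-allFin⁻ {n} g h x = All.lookup (All.all⁺ g (allFin n) h) (∈-allFin x)

all-allFin⁺ : ∀ {n} (g : Fin n → Bool) → (∀ x → T (g x)) → T (all g (allFin n))
all-allFin⁺ {n} g h = All.all⁻ g (All.tabulate {xs = allFin n} (λ {x} _ → h x))

any-allFin⁻ : ∀ {n} (g : Fin n → Bool) → T (any g (allFin n)) → ∃ λ x → T (g x)
any-allFin⁻ {n} g h = Any.satisfied (Any.any⁻ g (allFin n) h)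

any-allFin⁺ : ∀ {n} (g : Fin n → Bool) x → T (g x) → T (any g (allFin n))
any-allFin⁺ g x t = Any.any⁺ g (lose (∈-allFin x) t)

eqᵇ : {A : Set} → DecidableEquality A → A → A → Bool
eqᵇ _≟_ x y = ⌊ x ≟ y ⌋

module _ {A : Set} (_≟_ : DecidableEquality A) where

  eqᵇ-refl : ∀ x → T (eqᵇ _≟_ x x)
  eqᵇ-refl x = fromWitness {a? = x ≟ x} refl

  eqᵇ-sound : ∀ {x y} → T (eqᵇ _≟_ x y) → x ≡ y
  eqᵇ-sound {x} {y} = toWitness {a? = x ≟ y}

  eqᵇ-complete : ∀ {x y} → x ≡ y → T (eqᵇ _≟_ x y)
  eqᵇ-complete {x} refl = eqᵇ-refl x

  eqᵇ-sym : ∀ x y → eqᵇ _≟_ x y ≡ eqᵇ _≟_ y x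
  eqᵇ-sym x y = T⇔⇒≡ (eqᵇ-complete ∘ sym ∘ eqᵇ-sound) (eqᵇ-complete ∘ sym ∘ eqᵇ-sound)

  eqᵇ-∷ : ∀ {m} x y (xs ys : Vec A m) →
    eqᵇ (≡-dec _≟_) (x ∷ xs) (y ∷ ys) ≡ eqᵇ _≟_ x y ∧ eqᵇ (≡-dec _≟_) xs ys
  eqᵇ-∷ x y xs ys with x ≟ y | ≡-dec _≟_ xs ys
  ... | yes _ | yes _ = refl
  ... | yes _ | no _ = refl
  ... | no _ | _ = refl

sumList : {A : Set} → (A → ℕ) → List A → ℕ
sumList f [] = 0
sumList f (x ∷ xs) = f x + sumList f xs

module _ {A : Set} where

  sumList-cong : ∀ {f g : A → ℕ} → (∀ x → f x ≡ g x) → ∀ xs → sumList f xs ≡ sumList g xs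
  sumList-cong e [] = refl
  sumList-cong e (x ∷ xs) = cong₂ _+_ (e x) (sumList-cong e xs)

  sumList-congᴬ : ∀ {f g : A → ℕ} xs → All (λ x → f x ≡ g x) xs → sumList f xs ≡ sumList g xs
  sumList-congᴬ [] [] = refl
  sumList-congᴬ (x ∷ xs) (e ∷ es) = cong₂ _+_ e (sumList-congᴬ xs es)

  sumList-+ : ∀ (f g : A → ℕ) xs → sumList (λ x → f x + g x) xs ≡ sumList f xs + sumList g xs
  sumList-+ f g [] = refl
  sumList-+ f g (x ∷ xs) rewrite sumList-+ f g xs = interchange (f x) (g x) _ _

  sumList-0 : ∀ xs → sumList (λ (_ : A) → 0) xs ≡ 0
  sumList-0 [] = refl
  sumList-0 (x ∷ xs) = sumList-0 xs

  sumList-*ˡ : ∀ c (f : A → ℕ) xs → sumList (λ x → c * f x) xs ≡ c * sumList f xs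
  sumList-*ˡ c f [] = sym (*-zeroʳ c)
  sumList-*ˡ c f (x ∷ xs) rewrite sumList-*ˡ c f xs = sym (*-distribˡ-+ c (f x) _)

  sumList-++ : ∀ (f : A → ℕ) xs ys → sumList f (xs ++ ys) ≡ sumList f xs + sumList f ys
  sumList-++ f [] ys = refl
  sumList-++ f (x ∷ xs) ys rewrite sumList-++ f xs ys = sym (+-assoc (f x) _ _)

  sumList-filterᵇ : ∀ (P : A → Bool) (f : A → ℕ) xs → sumList f (filterᵇ P xs) ≡ sumList (λ x → 𝟙 (P x) * f x) xs
  sumList-filterᵇ P f [] = refl
  sumList-filterᵇ P f (x ∷ xs) with P x
  ... | true = cong₂ _+_ (sym (+-identityʳ (f x))) (sumList-filterᵇ P f xs)
  ... | false = sumList-filterᵇ P f xs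

  length-filterᵇ : ∀ (P : A → Bool) xs → length (filterᵇ P xs) ≡ sumList (λ x → 𝟙 (P x)) xs
  length-filterᵇ P [] = refl
  length-filterᵇ P (x ∷ xs) with P x
  ... | true = cong suc (length-filterᵇ P xs)
  ... | false = length-filterᵇ P xs

module _ {A B : Set} where

  sumList-map : ∀ (f : B → ℕ) (g : A → B) xs → sumList f (map g xs) ≡ sumList (f ∘ g) xs
  sumList-map f g [] = refl
  sumList-map f g (x ∷ xs) = cong (f (g x) +_) (sumList-map f g xs)

  sumList-concatMap : ∀ (f : B → ℕ) (g : A → List B) xs →
    sumList f (concatMap g xs) ≡ sumList (λ x → sumList f (g x)) xs
  sumList-concatMap f g [] = refl
  sumList-concatMap f g (x ∷ xs) =
    trans (sumList-++ f (g x) (concatMap g xs)) (cong (sumList f (g x) +_) (sumList-concatMap f g xs))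

  sumList-swap : ∀ (F : A → B → ℕ) xs ys →
    sumList (λ x → sumList (F x) ys) xs ≡ sumList (λ y → sumList (λ x → F x y) xs) ys
  sumList-swap F [] ys = sym (sumList-0 ys)
  sumList-swap F (x ∷ xs) ys rewrite sumList-swap F xs ys = sym (sumList-+ (F x) (λ y → sumList (λ x → F x y) xs) ys)

module _ {A : Set} (_≟_ : DecidableEquality A) where

  sumList-count : ∀ (F : A → ℕ) a xs →
    sumList (λ x → 𝟙 (eqᵇ _≟_ x a) * F x) xs ≡ sumList (λ x → 𝟙 (eqᵇ _≟_ x a)) xs * F a
  sumList-count F a [] = refl
  sumList-count F a (x ∷ xs) with x ≟ a
  ... | yes refl = cong₂ _+_ (+-identityʳ (F x)) (sumList-count F a xs)
  ... | no _ = sumList-count F a xs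



sumRange : ℕ → ℕ → (ℕ → ℕ) → ℕ
sumRange s zero f = 0
sumRange s (suc L) f = f s + sumRange (suc s) L f

sumRange-cong : ∀ {f g : ℕ → ℕ} s L → (∀ t → s ≤ t → t < s + L → f t ≡ g t) → sumRange s L f ≡ sumRange s L g
sumRange-cong s zero e = refl
sumRange-cong s (suc L) e = cong₂ _+_ (e s ≤-refl (m<m+n s (s≤s z≤n)))
  (sumRange-cong (suc s) L (λ t st tl → e t (≤-trans (n≤1+n s) st) (subst (t <_) (sym (+-suc s L)) tl)))

sumRange-+ : ∀ (f g : ℕ → ℕ) s L → sumRange s L (λ x → f x + g x) ≡ sumRange s L f + sumRange s L g
sumRange-+ f g s zero = refl
sumRange-+ f g s (suc L) rewrite sumRange-+ f g (suc s) L = interchange (f s) (g s) _ _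

sumRange-0 : ∀ s L → sumRange s L (λ _ → 0) ≡ 0
sumRange-0 s zero = refl
sumRange-0 s (suc L) = sumRange-0 (suc s) L

sumRange-zero : ∀ (f : ℕ → ℕ) s L → (∀ t → s ≤ t → t < s + L → f t ≡ 0) → sumRange s L f ≡ 0
sumRange-zero f s L h = trans (sumRange-cong s L h) (sumRange-0 s L)

sumRange-*ˡ : ∀ c (f : ℕ → ℕ) s L → sumRange s L (λ x → c * f x) ≡ c * sumRange s L f
sumRange-*ˡ c f s zero = sym (*-zeroʳ c)
sumRange-*ˡ c f s (suc L) rewrite sumRange-*ˡ c f (suc s) L = sym (*-distribˡ-+ c (f s) _)

sumRange-suc : ∀ (f : ℕ → ℕ) s L → sumRange (suc s) L f ≡ sumRange s L (f ∘ suc)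
sumRange-suc f s zero = refl
sumRange-suc f s (suc L) = cong (f (suc s) +_) (sumRange-suc f (suc s) L)

sumRange-translate : ∀ (f : ℕ → ℕ) a L → sumRange a L f ≡ sumRange 0 L (λ i → f (a + i))
sumRange-translate f a zero = refl
sumRange-translate f a (suc L) = cong₂ _+_ (cong f (sym (+-identityʳ a)))
  (trans (sumRange-translate f (suc a) L)
    (trans (sumRange-cong 0 L (λ i _ _ → cong f (sym (+-suc a i)))) (sym (sumRange-suc (λ i → f (a + i)) 0 L))))

sumRange-snoc : ∀ (f : ℕ → ℕ) s L → sumRange s (suc L) f ≡ sumRange s L f + f (s + L)
sumRange-snoc f s zero = trans (+-comm (f s) 0) (cong f (sym (+-identityʳ s)))
sumRange-snoc f s (suc L) =
  trans (cong (f s +_) (trans (sumRange-snoc f (suc s) L) (cong (λ z → sumRange (suc s) L f + f z) (sym (+-suc s L)))))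
    (sym (+-assoc (f s) _ _))

sumRange-reverse : ∀ (f : ℕ → ℕ) L → sumRange 0 L f ≡ sumRange 0 L (λ i → f (L ∸ suc i))
sumRange-reverse f zero = refl
sumRange-reverse f (suc L) = begin
  f 0 + sumRange 1 L f
    ≡⟨ cong (f 0 +_) (sumRange-suc f 0 L) ⟩
  f 0 + sumRange 0 L (f ∘ suc)
    ≡⟨ cong (f 0 +_) (sumRange-reverse (f ∘ suc) L) ⟩
  f 0 + sumRange 0 L (λ i → f (suc (L ∸ suc i)))
    ≡⟨ cong (f 0 +_) (sumRange-cong 0 L (λ i _ il → cong f (sym (+-∸-assoc 1 il)))) ⟩
  f 0 + sumRange 0 L (λ i → f (suc L ∸ suc i))
    ≡⟨ +-comm (f 0) _ ⟩
  sumRange 0 L (λ i → f (suc L ∸ suc i)) + f 0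
    ≡⟨ cong (λ z → sumRange 0 L (λ i → f (suc L ∸ suc i)) + f z) (n∸n≡0 L) ⟨
  sumRange 0 L (λ i → f (suc L ∸ suc i)) + f (suc L ∸ suc L)
    ≡⟨ sumRange-snoc (λ i → f (suc L ∸ suc i)) 0 L ⟨
  sumRange 0 (suc L) (λ i → f (suc L ∸ suc i)) ∎
  where open ≡-Reasoning

_==ℕ_ : ℕ → ℕ → Bool
_==ℕ_ = eqᵇ _≟_

sumRange-pick-outside : ∀ (f : ℕ → ℕ) s L a → a < s ⊎ s + L ≤ a → sumRange s L (λ v → 𝟙 (v ==ℕ a) * f v) ≡ 0
sumRange-pick-outside f s zero a _ = refl
sumRange-pick-outside f s (suc L) a h with s ≟ a
... | yes refl = ⊥-elim (Sum.[ <-irrefl refl , (λ q → <-irrefl refl (≤-trans (s≤s (m≤m+n s L)) (≤-trans (≤-reflexive (sym (+-suc s L))) q))) ] h)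
... | no _ = sumRange-pick-outside f (suc s) L a (Sum.map (λ q → ≤-trans q (n≤1+n s)) (λ q → ≤-trans (≤-reflexive (sym (+-suc s L))) q) h)

sumRange-pick : ∀ (f : ℕ → ℕ) s L a → s ≤ a → a < s + L → sumRange s L (λ v → 𝟙 (v ==ℕ a) * f v) ≡ f a
sumRange-pick f s zero a sa al = ⊥-elim (<-irrefl refl (≤-trans al (≤-trans (≤-reflexive (+-identityʳ s)) sa)))
sumRange-pick f s (suc L) a sa al with s ≟ a
... | yes refl = trans (cong₂ _+_ (+-identityʳ (f s)) (sumRange-pick-outside f (suc s) L s (inj₁ (n<1+n s)))) (+-identityʳ (f s))
... | no ne = sumRange-pick f (suc s) L a (≤∧≢⇒< sa ne) (≤-trans al (≤-reflexive (+-suc s L)))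

sumRange-upTo : ∀ (f : ℕ → ℕ) b s L → b < s + L → sumRange s L (λ v → 𝟙 (v ≤ᵇ b) * f v) ≡ sumRange s (suc b ∸ s) f
sumRange-upTo f b s zero bl rewrite m≤n⇒m∸n≡0 (subst (suc b ≤_) (+-identityʳ s) bl) = refl
sumRange-upTo f b s (suc L) bl with s ≤? b
... | yes sb rewrite T→≡ (≤⇒≤ᵇ sb) | +-∸-assoc 1 sb =
  cong₂ _+_ (+-identityʳ (f s)) (sumRange-upTo f b (suc s) L (subst (b <_) (+-suc s L) bl))
... | no nsb rewrite ¬T→≡ (λ h → nsb (≤ᵇ⇒≤ s b h)) | m≤n⇒m∸n≡0 (≰⇒> nsb) =
  sumRange-zero _ (suc s) L (λ v sv _ → cong (_* f v) (𝟙-¬T (λ h → nsb (≤-trans (n≤1+n s) (≤-trans sv (≤ᵇ⇒≤ v b h))))))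

sumRange-window : ∀ (f : ℕ → ℕ) a b s L → s ≤ a → b < s + L →
  sumRange s L (λ v → 𝟙 ((a ≤ᵇ v) ∧ (v ≤ᵇ b)) * f v) ≡ sumRange a (suc b ∸ a) f
sumRange-window f a b s zero sa bl =
  sym (cong (λ z → sumRange a z f) (m≤n⇒m∸n≡0 (≤-trans (subst (suc b ≤_) (+-identityʳ s) bl) sa)))
sumRange-window f a b s (suc L) sa bl with s ≟ a
... | yes refl = trans (sumRange-cong s (suc L) (λ v sv _ → cong (λ z → 𝟙 (z ∧ (v ≤ᵇ b)) * f v) (T→≡ (≤⇒≤ᵇ sv))))
  (sumRange-upTo f b s (suc L) bl)
... | no ne rewrite ¬T→≡ (λ h → <-irrefl refl (≤-trans (≤∧≢⇒< sa ne) (≤ᵇ⇒≤ a s h))) =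
  sumRange-window f a b (suc s) L (≤∧≢⇒< sa ne) (subst (b <_) (+-suc s L) bl)

-- Both sides sum the same arithmetic progression, read in opposite directions.
window-balance : ∀ m M N → M < N →
  sumRange 0 N (λ v → 𝟙 ((m ≤ᵇ v) ∧ (v ≤ᵇ M)) * (v ∸ m)) ≡ sumRange 0 N (λ v → 𝟙 ((m ≤ᵇ v) ∧ (v ≤ᵇ M)) * (M ∸ v))
window-balance m M N MN =
  trans (sumRange-window (_∸ m) m M 0 N z≤n MN) (trans reversed (sym (sumRange-window (M ∸_) m M 0 N z≤n MN)))
  where
  d = suc M ∸ m
  reversed : sumRange m d (_∸ m) ≡ sumRange m d (M ∸_)
  reversed = begin
    sumRange m d (_∸ m)                     ≡⟨ sumRange-translate _ m d ⟩
    sumRange 0 d (λ i → m + i ∸ m)           ≡⟨ sumRange-reverse _ d ⟩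
    sumRange 0 d (λ i → m + (d ∸ suc i) ∸ m) ≡⟨ sumRange-cong 0 d (λ i _ id → pointwise i id) ⟩
    sumRange 0 d (λ i → M ∸ (m + i))         ≡⟨ sumRange-translate _ m d ⟨
    sumRange m d (M ∸_)                     ∎
    where
    open ≡-Reasoning
    pointwise : ∀ i → i < 0 + d → m + (d ∸ suc i) ∸ m ≡ M ∸ (m + i)
    pointwise i id = trans (m+n∸m≡n m (d ∸ suc i)) (trans (∸-+-assoc (suc M) m (suc i)) (cong (suc M ∸_) (+-suc m i)))

window-balance-open : ∀ m M k → M ≤ k →
  sumRange 1 k (λ w → 𝟙 ((suc m ≤ᵇ w) ∧ (w ≤ᵇ M)) * (w ∸ m)) ≡ sumRange 1 k (λ w → 𝟙 ((suc m ≤ᵇ w) ∧ (w ≤ᵇ M)) * (suc M ∸ w))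
window-balance-open m M k Mk =
  trans (sumRange-window (_∸ m) (suc m) M 1 k (s≤s z≤n) (s≤s Mk))
    (trans reversed (sym (sumRange-window (suc M ∸_) (suc m) M 1 k (s≤s z≤n) (s≤s Mk))))
  where
  d = suc M ∸ suc m
  reversed : sumRange (suc m) d (_∸ m) ≡ sumRange (suc m) d (suc M ∸_)
  reversed = begin
    sumRange (suc m) d (_∸ m)                     ≡⟨ sumRange-translate _ (suc m) d ⟩
    sumRange 0 d (λ i → suc m + i ∸ m)             ≡⟨ sumRange-reverse _ d ⟩
    sumRange 0 d (λ i → suc m + (d ∸ suc i) ∸ m)   ≡⟨ sumRange-cong 0 d (λ i _ id → pointwise i id) ⟩
    sumRange 0 d (λ i → suc M ∸ (suc m + i))       ≡⟨ sumRange-translate _ (suc m) d ⟨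
    sumRange (suc m) d (suc M ∸_)                 ∎
    where
    open ≡-Reasoning
    pointwise : ∀ i → i < 0 + d → suc m + (d ∸ suc i) ∸ m ≡ suc M ∸ (suc m + i)
    pointwise i id = trans (trans (cong (_∸ m) (sym (+-suc m (d ∸ suc i)))) (m+n∸m≡n m (suc (d ∸ suc i))))
      (trans (sym (+-∸-assoc 1 id)) (∸-+-assoc (suc M) (suc m) i))

≤ᵇ-suc : ∀ a b → (suc a ≤ᵇ suc b) ≡ (a ≤ᵇ b)
≤ᵇ-suc a b = T⇔⇒≡ (λ t → ≤⇒≤ᵇ (≤-pred (≤ᵇ⇒≤ (suc a) (suc b) t))) (λ t → ≤⇒≤ᵇ (s≤s (≤ᵇ⇒≤ a b t)))

∸-sucʳ : ∀ a s → s < a → a ∸ s ≡ suc (a ∸ suc s)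
∸-sucʳ (suc a) zero _ = refl
∸-sucʳ (suc a) (suc s) (s≤s h) = ∸-sucʳ a s h

⊔-≤ᵇ : ∀ x y t → (x ⊔ y ≤ᵇ t) ≡ (x ≤ᵇ t) ∧ (y ≤ᵇ t)
⊔-≤ᵇ x y t = T⇔⇒≡
  (λ h → T∧ (≤⇒≤ᵇ (≤-trans (m≤m⊔n x y) (≤ᵇ⇒≤ (x ⊔ y) t h))) (≤⇒≤ᵇ (≤-trans (m≤n⊔m x y) (≤ᵇ⇒≤ (x ⊔ y) t h))))
  (λ h → ≤⇒≤ᵇ (⊔-lub (≤ᵇ⇒≤ x t (T∧₁ {x ≤ᵇ t} h)) (≤ᵇ⇒≤ y t (T∧₂ {x ≤ᵇ t} h))))

⊓-≤ᵇ : ∀ x y t → (x ⊓ y ≤ᵇ t) ≡ (x ≤ᵇ t) ∨ (y ≤ᵇ t)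
⊓-≤ᵇ x y t = T⇔⇒≡ fwd bwd
  where
  fwd : T (x ⊓ y ≤ᵇ t) → T ((x ≤ᵇ t) ∨ (y ≤ᵇ t))
  fwd h with ⊓-sel x y
  ... | inj₁ e = T∨₁ {x ≤ᵇ t} (subst (λ z → T (z ≤ᵇ t)) e h)
  ... | inj₂ e = T∨₂ {x ≤ᵇ t} (subst (λ z → T (z ≤ᵇ t)) e h)
  bwd : T ((x ≤ᵇ t) ∨ (y ≤ᵇ t)) → T (x ⊓ y ≤ᵇ t)
  bwd h with T∨⁻ {x ≤ᵇ t} h
  ... | inj₁ a = ≤⇒≤ᵇ (≤-trans (m⊓n≤m x y) (≤ᵇ⇒≤ x t a))
  ... | inj₂ b = ≤⇒≤ᵇ (≤-trans (m⊓n≤n x y) (≤ᵇ⇒≤ y t b))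

count-< : ∀ b s L → sumRange s L (λ t → 𝟙 (not (b ≤ᵇ t))) ≡ (b ∸ s) ⊓ L
count-< b s zero = sym (⊓-zeroʳ _)
count-< b s (suc L) rewrite count-< b (suc s) L with b ≤? s
... | yes bs rewrite T→≡ (≤⇒≤ᵇ bs) | m≤n⇒m∸n≡0 bs | m≤n⇒m∸n≡0 (m≤n⇒m≤1+n bs) = refl
... | no nbs rewrite ¬T→≡ (λ t → nbs (≤ᵇ⇒≤ b s t)) | ∸-sucʳ b s (≰⇒> nbs) = refl

count-between : ∀ a b K → b ≤ K → sumRange 0 K (λ t → 𝟙 ((a ≤ᵇ t) ∧ not (b ≤ᵇ t))) ≡ b ∸ a
count-between a b K bK with a ≤? b
... | no a≰b = trans (sumRange-zero _ 0 K (λ t _ _ → empty t)) (sym (m≤n⇒m∸n≡0 (<⇒≤ (≰⇒> a≰b))))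
  where
  empty : ∀ t → 𝟙 ((a ≤ᵇ t) ∧ not (b ≤ᵇ t)) ≡ 0
  empty t = 𝟙-¬T (λ h → a≰b (≤-trans (≤ᵇ⇒≤ a t (T∧₁ h)) (<⇒≤ (≰⇒> (λ bt → Tnot⁻ (T∧₂ {a ≤ᵇ t} h) (≤⇒≤ᵇ bt))))))
... | yes a≤b = begin
  X             ≡⟨ m+n∸n≡m X a ⟨
  X + a ∸ a     ≡⟨ cong (λ z → X + z ∸ a) (m≤n⇒m⊓n≡m (≤-trans a≤b bK)) ⟨
  X + a ⊓ K ∸ a ≡⟨ cong (_∸ a) split ⟩
  b ⊓ K ∸ a     ≡⟨ cong (_∸ a) (m≤n⇒m⊓n≡m bK) ⟩
  b ∸ a         ∎
  where
  open ≡-Reasoning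
  X = sumRange 0 K (λ t → 𝟙 ((a ≤ᵇ t) ∧ not (b ≤ᵇ t)))
  pointwise : ∀ t → 𝟙 ((a ≤ᵇ t) ∧ not (b ≤ᵇ t)) + 𝟙 (not (a ≤ᵇ t)) ≡ 𝟙 (not (b ≤ᵇ t))
  pointwise t with a ≤? t
  ... | yes at rewrite T→≡ (≤⇒≤ᵇ at) = +-identityʳ _
  ... | no nat rewrite ¬T→≡ (λ h → nat (≤ᵇ⇒≤ a t h)) | ¬T→≡ (λ h → nat (≤-trans a≤b (≤ᵇ⇒≤ b t h))) = refl
  split : X + a ⊓ K ≡ b ⊓ K
  split = trans (cong (X +_) (sym (count-< a 0 K)))
    (trans (sym (sumRange-+ _ _ 0 K)) (trans (sumRange-cong 0 K (λ t _ _ → pointwise t)) (count-< b 0 K)))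

allRange : ℕ → ℕ → (ℕ → Bool) → Bool
allRange s zero g = true
allRange s (suc L) g = g s ∧ allRange (suc s) L g

allRange⁻ : ∀ s L g → T (allRange s L g) → ∀ t → s ≤ t → t < s + L → T (g t)
allRange⁻ s zero g h t st tl = ⊥-elim (<-irrefl refl (≤-trans tl (≤-trans (≤-reflexive (+-identityʳ s)) st)))
allRange⁻ s (suc L) g h t st tl with s ≟ t
... | yes refl = T∧₁ h
... | no ne = allRange⁻ (suc s) L g (T∧₂ {g s} h) t (≤∧≢⇒< st ne) (≤-trans tl (≤-reflexive (+-suc s L)))

allRange⁺ : ∀ s L g → (∀ t → s ≤ t → t < s + L → T (g t)) → T (allRange s L g)
allRange⁺ s zero g h = tt
allRange⁺ s (suc L) g h = T∧ (h s ≤-refl (m<m+n s (s≤s z≤n)))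
  (allRange⁺ (suc s) L g (λ t st tl → h t (≤-trans (n≤1+n s) st) (≤-trans tl (≤-reflexive (sym (+-suc s L))))))

lookup-ext : ∀ {A : Set} {m} (xs ys : Vec A m) → (∀ i → lookup xs i ≡ lookup ys i) → xs ≡ ys
lookup-ext xs ys h = trans (sym (tabulate∘lookup xs)) (trans (tabulate-cong h) (tabulate∘lookup ys))

_==ᵛ_ : ∀ {m} → Vec ℕ m → Vec ℕ m → Bool
_==ᵛ_ = eqᵇ (≡-dec _≟_)

boundedBy : ∀ {m} → ℕ → Vec ℕ m → Bool
boundedBy B [] = true
boundedBy B (y ∷ ys) = (y ≤ᵇ B) ∧ boundedBy B ys

boundedBy⁻ : ∀ {m} B (f : Vec ℕ m) → T (boundedBy B f) → ∀ x → lookup f x ≤ B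
boundedBy⁻ B (y ∷ f) h zero = ≤ᵇ⇒≤ y B (T∧₁ h)
boundedBy⁻ B (y ∷ f) h (suc x) = boundedBy⁻ B f (T∧₂ {y ≤ᵇ B} h) x

boundedBy⁺ : ∀ {m} B (f : Vec ℕ m) → (∀ x → lookup f x ≤ B) → T (boundedBy B f)
boundedBy⁺ B [] h = tt
boundedBy⁺ B (y ∷ f) h = T∧ (≤⇒≤ᵇ (h zero)) (boundedBy⁺ B f (h ∘ suc))

sumBounded : (m B : ℕ) → (Vec ℕ m → ℕ) → ℕ
sumBounded zero B F = F []
sumBounded (suc m) B F = sumRange 0 (suc B) (λ v → sumBounded m B (λ g → F (v ∷ g)))

sumBounded-cong : ∀ m B {F G : Vec ℕ m → ℕ} → (∀ f → T (boundedBy B f) → F f ≡ G f) → sumBounded m B F ≡ sumBounded m B G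
sumBounded-cong zero B e = e [] tt
sumBounded-cong (suc m) B e =
  sumRange-cong 0 (suc B) (λ t _ tl → sumBounded-cong m B (λ g bg → e (t ∷ g) (T∧ (≤⇒≤ᵇ (≤-pred tl)) bg)))

sumBounded-+ : ∀ m B (F G : Vec ℕ m → ℕ) → sumBounded m B (λ f → F f + G f) ≡ sumBounded m B F + sumBounded m B G
sumBounded-+ zero B F G = refl
sumBounded-+ (suc m) B F G =
  trans (sumRange-cong 0 (suc B) (λ v _ _ → sumBounded-+ m B (λ g → F (v ∷ g)) (λ g → G (v ∷ g))))
    (sumRange-+ (λ v → sumBounded m B (λ g → F (v ∷ g))) (λ v → sumBounded m B (λ g → G (v ∷ g))) 0 (suc B))

sumBounded-0 : ∀ m B → sumBounded m B (λ _ → 0) ≡ 0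
sumBounded-0 zero B = refl
sumBounded-0 (suc m) B = trans (sumRange-cong 0 (suc B) (λ v _ _ → sumBounded-0 m B)) (sumRange-0 0 (suc B))

sumBounded-*ˡ : ∀ m B c (F : Vec ℕ m → ℕ) → sumBounded m B (λ f → c * F f) ≡ c * sumBounded m B F
sumBounded-*ˡ zero B c F = refl
sumBounded-*ˡ (suc m) B c F =
  trans (sumRange-cong 0 (suc B) (λ v _ _ → sumBounded-*ˡ m B c (λ g → F (v ∷ g))))
    (sumRange-*ˡ c (λ v → sumBounded m B (λ g → F (v ∷ g))) 0 (suc B))

sumBounded-swapRange : ∀ m B (F : Vec ℕ m → ℕ → ℕ) s L →
  sumBounded m B (λ f → sumRange s L (F f)) ≡ sumRange s L (λ t → sumBounded m B (λ f → F f t))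
sumBounded-swapRange m B F s zero = sumBounded-0 m B
sumBounded-swapRange m B F s (suc L) =
  trans (sumBounded-+ m B (λ f → F f s) (λ f → sumRange (suc s) L (F f)))
    (cong (sumBounded m B (λ f → F f s) +_) (sumBounded-swapRange m B F (suc s) L))

sumBounded-swap : ∀ m B m′ B′ (F : Vec ℕ m → Vec ℕ m′ → ℕ) →
  sumBounded m B (λ f → sumBounded m′ B′ (F f)) ≡ sumBounded m′ B′ (λ g → sumBounded m B (λ f → F f g))
sumBounded-swap zero B m′ B′ F = refl
sumBounded-swap (suc m) B m′ B′ F =
  trans (sumRange-cong 0 (suc B) (λ v _ _ → sumBounded-swap m B m′ B′ (λ f → F (v ∷ f))))
    (sym (sumBounded-swapRange m′ B′ (λ g v → sumBounded m B (λ f → F (v ∷ f) g)) 0 (suc B)))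

sumList-swapBounded : ∀ {A : Set} m B (F : A → Vec ℕ m → ℕ) xs →
  sumList (λ x → sumBounded m B (F x)) xs ≡ sumBounded m B (λ f → sumList (λ x → F x f) xs)
sumList-swapBounded m B F [] = sym (sumBounded-0 m B)
sumList-swapBounded m B F (x ∷ xs) =
  trans (cong (sumBounded m B (F x) +_) (sumList-swapBounded m B F xs)) (sym (sumBounded-+ m B (F x) _))

sumBounded-pick : ∀ m B (F : Vec ℕ m → ℕ) g → sumBounded m B (λ f → 𝟙 (f ==ᵛ g) * F f) ≡ 𝟙 (boundedBy B g) * F g
sumBounded-pick zero B F [] = refl
sumBounded-pick (suc m) B F (a ∷ g) = trans (sumRange-cong 0 (suc B) (λ v _ _ → inner v)) outer
  where
  inner : ∀ v → sumBounded m B (λ h → 𝟙 ((v ∷ h) ==ᵛ (a ∷ g)) * F (v ∷ h)) ≡ 𝟙 (v ==ℕ a) * (𝟙 (boundedBy B g) * F (v ∷ g))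
  inner v = trans (sumBounded-cong m B (λ h _ → trans (cong (λ z → 𝟙 z * F (v ∷ h)) (eqᵇ-∷ _≟_ v a h g)) (𝟙-∧-* (v ==ℕ a) (h ==ᵛ g) _)))
    (trans (sumBounded-*ˡ m B (𝟙 (v ==ℕ a)) (λ h → 𝟙 (h ==ᵛ g) * F (v ∷ h)))
      (cong (𝟙 (v ==ℕ a) *_) (sumBounded-pick m B (λ h → F (v ∷ h)) g)))
  outer : sumRange 0 (suc B) (λ v → 𝟙 (v ==ℕ a) * (𝟙 (boundedBy B g) * F (v ∷ g))) ≡ 𝟙 (boundedBy B (a ∷ g)) * F (a ∷ g)
  outer with a ≤? B
  ... | yes aB = trans (sumRange-pick (λ v → 𝟙 (boundedBy B g) * F (v ∷ g)) 0 (suc B) a z≤n (s≤s aB))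
    (cong (λ z → 𝟙 (z ∧ boundedBy B g) * F (a ∷ g)) (sym (T→≡ (≤⇒≤ᵇ aB))))
  ... | no naB = trans (sumRange-pick-outside (λ v → 𝟙 (boundedBy B g) * F (v ∷ g)) 0 (suc B) a (inj₂ (≰⇒> naB)))
    (sym (cong (λ z → 𝟙 (z ∧ boundedBy B g) * F (a ∷ g)) (¬T→≡ (λ t → naB (≤ᵇ⇒≤ a B t)))))

sumBounded-pick-∧ : ∀ m B b (F : Vec ℕ m → ℕ) x → T (boundedBy B x) → sumBounded m B (λ g → 𝟙 (b ∧ (g ==ᵛ x)) * F g) ≡ 𝟙 b * F x
sumBounded-pick-∧ m B b F x bx = begin
  sumBounded m B (λ g → 𝟙 (b ∧ (g ==ᵛ x)) * F g)   ≡⟨ sumBounded-cong m B (λ g _ → 𝟙-∧-* b (g ==ᵛ x) (F g)) ⟩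
  sumBounded m B (λ g → 𝟙 b * (𝟙 (g ==ᵛ x) * F g)) ≡⟨ sumBounded-*ˡ m B (𝟙 b) (λ g → 𝟙 (g ==ᵛ x) * F g) ⟩
  𝟙 b * sumBounded m B (λ g → 𝟙 (g ==ᵛ x) * F g)   ≡⟨ cong (𝟙 b *_) (sumBounded-pick m B F x) ⟩
  𝟙 b * (𝟙 (boundedBy B x) * F x)                  ≡⟨ cong (λ z → 𝟙 b * (𝟙 z * F x)) (T→≡ bx) ⟩
  𝟙 b * (1 * F x)                                  ≡⟨ cong (𝟙 b *_) (*-identityˡ (F x)) ⟩
  𝟙 b * F x                                        ∎
  where open ≡-Reasoning

sumBounded-fiber : ∀ m B (p : Fin m) (F : Vec ℕ m → ℕ) →
  sumBounded m B F ≡ sumBounded m B (λ g → 𝟙 (lookup g p ==ℕ 0) * sumRange 0 (suc B) (λ v → F (g [ p ]≔ v)))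
sumBounded-fiber (suc m) B zero F = sym (begin
  sumRange 0 (suc B) (λ x → sumBounded m B (λ r → 𝟙 (x ==ℕ 0) * sumRange 0 (suc B) (λ v → F (v ∷ r))))
    ≡⟨ sumRange-cong 0 (suc B) (λ x _ _ → sumBounded-*ˡ m B (𝟙 (x ==ℕ 0)) (λ r → sumRange 0 (suc B) (λ v → F (v ∷ r)))) ⟩
  sumRange 0 (suc B) (λ x → 𝟙 (x ==ℕ 0) * sumBounded m B (λ r → sumRange 0 (suc B) (λ v → F (v ∷ r))))
    ≡⟨ sumRange-pick (λ _ → sumBounded m B (λ r → sumRange 0 (suc B) (λ v → F (v ∷ r)))) 0 (suc B) 0 z≤n (s≤s z≤n) ⟩
  sumBounded m B (λ r → sumRange 0 (suc B) (λ v → F (v ∷ r)))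
    ≡⟨ sumBounded-swapRange m B (λ r v → F (v ∷ r)) 0 (suc B) ⟩
  sumRange 0 (suc B) (λ v → sumBounded m B (λ r → F (v ∷ r))) ∎)
  where open ≡-Reasoning
sumBounded-fiber (suc m) B (suc p) F = sumRange-cong 0 (suc B) (λ x _ _ → sumBounded-fiber m B p (λ r → F (x ∷ r)))

interval : ℕ → ℕ → List ℕ
interval s zero = []
interval s (suc L) = s ∷ interval (suc s) L

module _ (Q : ℕ → Bool) where

  ∈-filter-interval⁻ : ∀ s L {x} → x ∈ filterᵇ Q (interval s L) → s ≤ x × x < s + L × T (Q x)
  ∈-filter-interval⁻ s (suc L) m with Q s in e
  ∈-filter-interval⁻ s (suc L) (here refl) | true = ≤-refl , m<m+n s (s≤s z≤n) , ≡→T e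
  ∈-filter-interval⁻ s (suc L) (there m) | true with ∈-filter-interval⁻ (suc s) L m
  ... | a , b , c = ≤-trans (n≤1+n s) a , ≤-trans b (≤-reflexive (sym (+-suc s L))) , c
  ∈-filter-interval⁻ s (suc L) m | false with ∈-filter-interval⁻ (suc s) L m
  ... | a , b , c = ≤-trans (n≤1+n s) a , ≤-trans b (≤-reflexive (sym (+-suc s L))) , c

  ∈-filter-interval⁺ : ∀ s L x → s ≤ x → x < s + L → T (Q x) → x ∈ filterᵇ Q (interval s L)
  ∈-filter-interval⁺ s zero x sx xl q = ⊥-elim (<-irrefl refl (≤-trans xl (≤-trans (≤-reflexive (+-identityʳ s)) sx)))
  ∈-filter-interval⁺ s (suc L) x sx xl q with s ≟ x
  ... | yes refl rewrite T→≡ q = here refl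
  ... | no ne with Q s
  ...   | true = there (∈-filter-interval⁺ (suc s) L x (≤∧≢⇒< sx ne) (≤-trans xl (≤-reflexive (+-suc s L))) q)
  ...   | false = ∈-filter-interval⁺ (suc s) L x (≤∧≢⇒< sx ne) (≤-trans xl (≤-reflexive (+-suc s L))) q

  filter-interval-sorted : ∀ s L a b r → filterᵇ Q (interval s L) ≡ a ∷ b ∷ r → a < b
  filter-interval-sorted s (suc L) a b r e with Q s
  ... | true = subst (_< b) (∷-injectiveˡ e)
    (proj₁ (∈-filter-interval⁻ (suc s) L (subst (b ∈_) (sym (∷-injectiveʳ e)) (here refl))))
  ... | false = filter-interval-sorted (suc s) L a b r e

  filter-interval-none : ∀ s L → (∀ j → s ≤ j → j < s + L → ¬ T (Q j)) → filterᵇ Q (interval s L) ≡ []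
  filter-interval-none s zero h = refl
  filter-interval-none s (suc L) h with Q s in e
  ... | true = ⊥-elim (h s ≤-refl (m<m+n s (s≤s z≤n)) (≡→T e))
  ... | false = filter-interval-none (suc s) L
    (λ j sj jl → h j (≤-trans (n≤1+n s) sj) (≤-trans jl (≤-reflexive (sym (+-suc s L)))))

  filter-interval-single : ∀ s L w → s ≤ w → w < s + L → (∀ j → s ≤ j → j < s + L → T (Q j) → j ≡ w) → T (Q w) →
    filterᵇ Q (interval s L) ≡ w ∷ []
  filter-interval-single s zero w sw wl h q = ⊥-elim (<-irrefl refl (≤-trans wl (≤-trans (≤-reflexive (+-identityʳ s)) sw)))
  filter-interval-single s (suc L) w sw wl h q with s ≟ w
  ... | yes refl rewrite T→≡ q = cong (s ∷_) (filter-interval-none (suc s) L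
    (λ j sj jl qj → <-irrefl (sym (h j (≤-trans (n≤1+n s) sj) (≤-trans jl (≤-reflexive (sym (+-suc s L)))) qj)) sj))
  ... | no ne with Q s in e
  ...   | true = ⊥-elim (ne (h s ≤-refl (m<m+n s (s≤s z≤n)) (≡→T e)))
  ...   | false = filter-interval-single (suc s) L w (≤∧≢⇒< sw ne) (≤-trans wl (≤-reflexive (+-suc s L)))
    (λ j sj jl → h j (≤-trans (n≤1+n s) sj) (≤-trans jl (≤-reflexive (sym (+-suc s L))))) q

onSingleton : List ℕ → (ℕ → ℕ) → ℕ
onSingleton (w ∷ []) F = F w
onSingleton _ F = 0

isSingletonOf : List ℕ → ℕ → Bool
isSingletonOf (x ∷ []) w = w ==ℕ x
isSingletonOf _ w = false

isSingletonOf-sound : ∀ L w → T (isSingletonOf L w) → L ≡ w ∷ []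
isSingletonOf-sound (x ∷ []) w t = cong (_∷ []) (sym (eqᵇ-sound _≟_ t))

null-sound : ∀ (L : List ℕ) → T (null L) → L ≡ []
null-sound [] _ = refl

punchIn : ℕ → ℕ → ℕ
punchIn w a = if a <ᵇ w then a else suc a

punchOut : ℕ → ℕ → ℕ
punchOut w a = if a <ᵇ w then a else pred a

punchIn-< : ∀ w a → a < w → punchIn w a ≡ a
punchIn-< w a h rewrite T→≡ (<⇒<ᵇ h) = refl

punchIn-≥ : ∀ w a → w ≤ a → punchIn w a ≡ suc a
punchIn-≥ w a h rewrite ¬T→≡ (λ t → <-irrefl refl (≤-trans (<ᵇ⇒< a w t) h)) = refl

punchOut-< : ∀ w a → a < w → punchOut w a ≡ a
punchOut-< w a h rewrite T→≡ (<⇒<ᵇ h) = refl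

punchOut-≥ : ∀ w a → w ≤ a → punchOut w a ≡ pred a
punchOut-≥ w a h rewrite ¬T→≡ (λ t → <-irrefl refl (≤-trans (<ᵇ⇒< a w t) h)) = refl

punchIn-≢ : ∀ w a → punchIn w a ≢ w
punchIn-≢ w a with a <? w
... | yes aw rewrite punchIn-< w a aw = λ e → <-irrefl e aw
... | no naw rewrite punchIn-≥ w a (≮⇒≥ naw) = λ e → <-irrefl (sym e) (s≤s (≮⇒≥ naw))

punchOut-punchIn : ∀ w a → punchOut w (punchIn w a) ≡ a
punchOut-punchIn w a with a <? w
... | yes aw rewrite punchIn-< w a aw = punchOut-< w a aw
... | no naw rewrite punchIn-≥ w a (≮⇒≥ naw) = punchOut-≥ w (suc a) (m≤n⇒m≤1+n (≮⇒≥ naw))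

punchIn-punchOut : ∀ w a → a ≢ w → punchIn w (punchOut w a) ≡ a
punchIn-punchOut w a ne with a <? w
... | yes aw rewrite punchOut-< w a aw = punchIn-< w a aw
... | no naw = above w a (≤∧≢⇒< (≮⇒≥ naw) (ne ∘ sym))
  where
  above : ∀ w a → w < a → punchIn w (punchOut w a) ≡ a
  above w (suc a′) (s≤s wa′) rewrite punchOut-≥ w (suc a′) (m≤n⇒m≤1+n wa′) = punchIn-≥ w a′ wa′

punchIn-mono : ∀ w {a b} → a ≤ b → punchIn w a ≤ punchIn w b
punchIn-mono w {a} {b} ab with a <? w | b <? w
... | yes aw | yes bw rewrite punchIn-< w a aw | punchIn-< w b bw = ab
... | yes aw | no bw rewrite punchIn-< w a aw | punchIn-≥ w b (≮⇒≥ bw) = m≤n⇒m≤1+n ab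
... | no aw | yes bw = ⊥-elim (aw (≤-<-trans ab bw))
... | no aw | no bw rewrite punchIn-≥ w a (≮⇒≥ aw) | punchIn-≥ w b (≮⇒≥ bw) = s≤s ab

punchOut-mono : ∀ w {a b} → a ≤ b → punchOut w a ≤ punchOut w b
punchOut-mono w {a} {b} ab with a <? w | b <? w
... | yes aw | yes bw rewrite punchOut-< w a aw | punchOut-< w b bw = ab
... | yes aw | no bw rewrite punchOut-< w a aw | punchOut-≥ w b (≮⇒≥ bw) = suc[m]≤n⇒m≤pred[n] (<-≤-trans aw (≮⇒≥ bw))
... | no aw | yes bw = ⊥-elim (aw (≤-<-trans ab bw))
... | no aw | no bw rewrite punchOut-≥ w a (≮⇒≥ aw) | punchOut-≥ w b (≮⇒≥ bw) = pred-mono-≤ ab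

punchIn-≤ : ∀ k w a → a ≤ k → punchIn w a ≤ suc k
punchIn-≤ k w a ak with a <? w
... | yes aw rewrite punchIn-< w a aw = m≤n⇒m≤1+n ak
... | no naw rewrite punchIn-≥ w a (≮⇒≥ naw) = s≤s ak

punchOut-≤ : ∀ k w a → w ≤ k → a ≤ suc k → punchOut w a ≤ k
punchOut-≤ k w a wk ak with a <? w
... | yes aw rewrite punchOut-< w a aw = ≤-trans (<⇒≤ aw) wk
... | no naw rewrite punchOut-≥ w a (≮⇒≥ naw) = pred-mono-≤ ak

punchIn-⊔ : ∀ w a b → punchIn w (a ⊔ b) ≡ punchIn w a ⊔ punchIn w b
punchIn-⊔ w a b with a ≤? b
... | yes ab rewrite m≤n⇒m⊔n≡n ab | m≤n⇒m⊔n≡n (punchIn-mono w ab) = refl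
... | no nab rewrite m≥n⇒m⊔n≡m (<⇒≤ (≰⇒> nab)) | m≥n⇒m⊔n≡m (punchIn-mono w (<⇒≤ (≰⇒> nab))) = refl

punchIn-⊓ : ∀ w a b → punchIn w (a ⊓ b) ≡ punchIn w a ⊓ punchIn w b
punchIn-⊓ w a b with a ≤? b
... | yes ab rewrite m≤n⇒m⊓n≡m ab | m≤n⇒m⊓n≡m (punchIn-mono w ab) = refl
... | no nab rewrite m≥n⇒m⊓n≡n (<⇒≤ (≰⇒> nab)) | m≥n⇒m⊓n≡n (punchIn-mono w (<⇒≤ (≰⇒> nab))) = refl

punchIn-window : ∀ w m M → (punchIn w m ≤ᵇ w) ∧ (w ≤ᵇ punchIn w M) ≡ (suc m ≤ᵇ w) ∧ (w ≤ᵇ M)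
punchIn-window w m M = T⇔⇒≡ fwd bwd
  where
  fwd : T ((punchIn w m ≤ᵇ w) ∧ (w ≤ᵇ punchIn w M)) → T ((suc m ≤ᵇ w) ∧ (w ≤ᵇ M))
  fwd t with m <? w | w ≤? M
  ... | yes mw | yes wM = T∧ (≤⇒≤ᵇ mw) (≤⇒≤ᵇ wM)
  ... | yes mw | no nwM = ⊥-elim (nwM (subst (w ≤_) (punchIn-< w M (≰⇒> nwM)) (≤ᵇ⇒≤ w (punchIn w M) (T∧₂ {punchIn w m ≤ᵇ w} t))))
  ... | no nmw | _ = ⊥-elim (<-irrefl refl (≤-trans (s≤s (≮⇒≥ nmw))
    (subst (_≤ w) (punchIn-≥ w m (≮⇒≥ nmw)) (≤ᵇ⇒≤ (punchIn w m) w (T∧₁ t)))))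
  bwd : T ((suc m ≤ᵇ w) ∧ (w ≤ᵇ M)) → T ((punchIn w m ≤ᵇ w) ∧ (w ≤ᵇ punchIn w M))
  bwd t = T∧ (≤⇒≤ᵇ (subst (_≤ w) (sym (punchIn-< w m mw)) (<⇒≤ mw)))
             (≤⇒≤ᵇ (subst (w ≤_) (sym (punchIn-≥ w M wM)) (m≤n⇒m≤1+n wM)))
    where
    mw = ≤ᵇ⇒≤ (suc m) w (T∧₁ t)
    wM = ≤ᵇ⇒≤ w M (T∧₂ {suc m ≤ᵇ w} t)

punchIn-window-below : ∀ w m M →
  𝟙 ((punchIn w m ≤ᵇ w) ∧ (w ≤ᵇ punchIn w M)) * (w ∸ punchIn w m) ≡ 𝟙 ((suc m ≤ᵇ w) ∧ (w ≤ᵇ M)) * (w ∸ m)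
punchIn-window-below w m M rewrite punchIn-window w m M with (suc m ≤ᵇ w) ∧ (w ≤ᵇ M) in e
... | false = refl
... | true rewrite punchIn-< w m (≤ᵇ⇒≤ (suc m) w (T∧₁ (≡→T e))) = refl

punchIn-window-above : ∀ w m M →
  𝟙 ((punchIn w m ≤ᵇ w) ∧ (w ≤ᵇ punchIn w M)) * (punchIn w M ∸ w) ≡ 𝟙 ((suc m ≤ᵇ w) ∧ (w ≤ᵇ M)) * (suc M ∸ w)
punchIn-window-above w m M rewrite punchIn-window w m M with (suc m ≤ᵇ w) ∧ (w ≤ᵇ M) in e
... | false = refl
... | true rewrite punchIn-≥ w M (≤ᵇ⇒≤ w M (T∧₂ {suc m ≤ᵇ w} (≡→T e))) = refl

count-allSubsets : ∀ n (a : Subset n) → sumList (λ I → 𝟙 (I ==ˢ a)) (allSubsets n) ≡ 1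
count-allSubsets zero [] = refl
count-allSubsets (suc n) (b ∷ a) =
  trans (sumList-concatMap (λ I → 𝟙 (I ==ˢ (b ∷ a))) (λ s → (false ∷ s) ∷ (true ∷ s) ∷ []) (allSubsets n))
    (trans (sumList-cong (extend b) (allSubsets n)) (count-allSubsets n a))
  where
  extend : ∀ b s → 𝟙 ((false ∷ s) ==ˢ (b ∷ a)) + (𝟙 ((true ∷ s) ==ˢ (b ∷ a)) + 0) ≡ 𝟙 (s ==ˢ a)
  extend b s rewrite eqᵇ-∷ Bool._≟_ false b s a | eqᵇ-∷ Bool._≟_ true b s a with b
  ... | false = +-identityʳ _
  ... | true = +-identityʳ _

module _ (P : FinPoset) where
  open FinPoset P using (n; _≼_) renaming (_≤?_ to _≼?_)

  frac-+ : ∀ a b D → frac P a D ℚ.+ frac P b D ≡ frac P (a + b) D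
  frac-+ a b zero = ℚₚ.+-identityˡ 0ℚ
  frac-+ a b (suc d) = ℚₚ.toℚᵘ-injective
    (ℚᵘₚ.≃-trans (ℚₚ.toℚᵘ-homo-+ (ℤ.+ a ℚ./ suc d) (ℤ.+ b ℚ./ suc d))
    (ℚᵘₚ.≃-trans (ℚᵘₚ.+-cong (ℚₚ.toℚᵘ-fromℚᵘ (mkℚᵘ (ℤ.+ a) d)) (ℚₚ.toℚᵘ-fromℚᵘ (mkℚᵘ (ℤ.+ b) d)))
    (ℚᵘₚ.≃-trans sum-unnormalised (ℚᵘₚ.≃-sym (ℚₚ.toℚᵘ-fromℚᵘ (mkℚᵘ (ℤ.+ (a + b)) d))))))
    where
    D = suc d
    sum-unnormalised : (mkℚᵘ (ℤ.+ a) d ℚᵘ.+ mkℚᵘ (ℤ.+ b) d) ℚᵘ.≃ mkℚᵘ (ℤ.+ (a + b)) d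
    sum-unnormalised = *≡* (begin
      (ℤ.+ a ℤ.* ℤ.+ D ℤ.+ ℤ.+ b ℤ.* ℤ.+ D) ℤ.* ℤ.+ D
        ≡⟨ cong (ℤ._* ℤ.+ D) (cong₂ ℤ._+_ (ℤ.pos-* a D) (ℤ.pos-* b D)) ⟨
      (ℤ.+ (a * D) ℤ.+ ℤ.+ (b * D)) ℤ.* ℤ.+ D
        ≡⟨ cong (ℤ._* ℤ.+ D) (ℤ.pos-+ (a * D) (b * D)) ⟨
      ℤ.+ (a * D + b * D) ℤ.* ℤ.+ D
        ≡⟨ ℤ.pos-* (a * D + b * D) D ⟨
      ℤ.+ ((a * D + b * D) * D)
        ≡⟨ cong ℤ.+_ (trans (cong (_* D) (sym (*-distribʳ-+ D a b))) (*-assoc (a + b) D D)) ⟩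
      ℤ.+ ((a + b) * (D * D))
        ≡⟨ ℤ.pos-* (a + b) (D * D) ⟩
      ℤ.+ (a + b) ℤ.* ℤ.+ (D * D) ∎)
      where open ≡-Reasoning

  frac-0 : ∀ D → frac P 0 D ≡ 0ℚ
  frac-0 zero = refl
  frac-0 (suc d) = ℚₚ.0/n≡0 (suc d)

  frac-indicator : ∀ a s D b → frac P a D ℚ.* (if b then 1ℚ else 0ℚ) ℚ.+ frac P s D ≡ frac P (𝟙 b * a + s) D
  frac-indicator a s D true = trans (cong (ℚ._+ frac P s D) (ℚₚ.*-identityʳ (frac P a D)))
    (trans (frac-+ a s D) (cong (λ z → frac P (z + s) D) (sym (*-identityˡ a))))
  frac-indicator a s D false = trans (cong (ℚ._+ frac P s D) (ℚₚ.*-zeroʳ (frac P a D))) (ℚₚ.+-identityˡ _)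

  foldr-frac : ∀ (a : Subset n → ℕ) D (f : Subset n → Bool) L →
    foldr (λ I acc → frac P (a I) D ℚ.* (if f I then 1ℚ else 0ℚ) ℚ.+ acc) 0ℚ L ≡ frac P (sumList (λ I → 𝟙 (f I) * a I) L) D
  foldr-frac a D f [] = sym (frac-0 D)
  foldr-frac a D f (I ∷ L) =
    trans (cong (λ z → frac P (a I) D ℚ.* (if f I then 1ℚ else 0ℚ) ℚ.+ z) (foldr-frac a D f L)) (frac-indicator (a I) _ D (f I))

  chainTotal : ℕ → (Subset n → Bool) → ℕ
  chainTotal k f = sumList (λ I → 𝟙 (f I) * chainsThrough P k I) (J P)

  expect-chainDist : ∀ k f → expect P (chainDist P k) f ≡ frac P (chainTotal k f) (suc k * length (chains P k))
  expect-chainDist k f = foldr-frac (chainsThrough P k) (suc k * length (chains P k)) f (J P)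

  count-J : ∀ a → sumList (λ I → 𝟙 (I ==ˢ a)) (J P) ≡ 𝟙 (isIdeal P a)
  count-J a = begin
    sumList (λ I → 𝟙 (I ==ˢ a)) (J P)
      ≡⟨ sumList-filterᵇ (isIdeal P) (λ I → 𝟙 (I ==ˢ a)) (allSubsets n) ⟩
    sumList (λ I → 𝟙 (isIdeal P I) * 𝟙 (I ==ˢ a)) (allSubsets n)
      ≡⟨ sumList-cong (λ I → *-comm (𝟙 (isIdeal P I)) (𝟙 (I ==ˢ a))) (allSubsets n) ⟩
    sumList (λ I → 𝟙 (I ==ˢ a) * 𝟙 (isIdeal P I)) (allSubsets n)
      ≡⟨ sumList-count (≡-dec Bool._≟_) (λ I → 𝟙 (isIdeal P I)) a (allSubsets n) ⟩
    sumList (λ I → 𝟙 (I ==ˢ a)) (allSubsets n) * 𝟙 (isIdeal P a)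
      ≡⟨ cong (_* 𝟙 (isIdeal P a)) (count-allSubsets n a) ⟩
    1 * 𝟙 (isIdeal P a)
      ≡⟨ *-identityˡ _ ⟩
    𝟙 (isIdeal P a) ∎
    where open ≡-Reasoning

  _==ᶜ_ : ∀ {m} → Vec (Subset n) m → Vec (Subset n) m → Bool
  _==ᶜ_ = eqᵇ (≡-dec (≡-dec Bool._≟_))

  isChain : ∀ {k} → Vec (Subset n) (suc k) → Bool
  isChain {zero} (c ∷ []) = isIdeal P c
  isChain {suc k} (c ∷ cs) = isIdeal P c ∧ (c ⊊ᵇ head cs) ∧ isChain cs

  all-J-ideal : All (T ∘ isIdeal P) (J P)
  all-J-ideal = All.all-filter (T? ∘ isIdeal P) (allSubsets n)

  all-chains-isChain : ∀ k → All (T ∘ isChain) (chains P k)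
  all-chains-isChain zero = All.map⁺ all-J-ideal
  all-chains-isChain (suc k) = All.concat⁺ (All.map⁺ (All.map extend (all-chains-isChain k)))
    where
    extend : ∀ {c} → T (isChain c) → All (T ∘ isChain) (map (_∷ c) (filterᵇ (_⊊ᵇ head c) (J P)))
    extend {c} ic = All.map⁺ (All.zipWith (λ {I} h → T∧ {isIdeal P I} (proj₁ h) (T∧ (proj₂ h) ic))
      (All.filter⁺ (T? ∘ (_⊊ᵇ head c)) all-J-ideal , All.all-filter (T? ∘ (_⊊ᵇ head c)) (J P)))

  count-chains : ∀ k (c : Vec (Subset n) (suc k)) → sumList (λ d → 𝟙 (d ==ᶜ c)) (chains P k) ≡ 𝟙 (isChain c)
  count-chains zero (a ∷ []) = trans (sumList-map _ (_∷ []) (J P))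
    (trans (sumList-cong (λ I → cong 𝟙 (trans (eqᵇ-∷ (≡-dec Bool._≟_) I a [] []) (Bool.∧-identityʳ _))) (J P)) (count-J a))
  count-chains (suc k) (a ∷ c) = begin
    sumList (λ d → 𝟙 (d ==ᶜ (a ∷ c))) (chains P (suc k))
      ≡⟨ sumList-concatMap _ _ (chains P k) ⟩
    sumList (λ d → sumList (λ e → 𝟙 (e ==ᶜ (a ∷ c))) (map (_∷ d) (below d))) (chains P k)
      ≡⟨ sumList-cong (λ d → trans (sumList-map (λ e → 𝟙 (e ==ᶜ (a ∷ c))) (_∷ d) (below d))
                         (sumList-filterᵇ (_⊊ᵇ head d) (λ I → 𝟙 ((I ∷ d) ==ᶜ (a ∷ c))) (J P))) (chains P k) ⟩
    sumList (λ d → sumList (λ I → 𝟙 (I ⊊ᵇ head d) * 𝟙 ((I ∷ d) ==ᶜ (a ∷ c))) (J P)) (chains P k)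
      ≡⟨ sumList-cong (λ d → trans (sumList-cong (λ I → factor d I) (J P)) (sumList-*ˡ (𝟙 (d ==ᶜ c)) _ (J P))) (chains P k) ⟩
    sumList (λ d → 𝟙 (d ==ᶜ c) * extensions d) (chains P k)
      ≡⟨ sumList-cong (λ d → only-c d) (chains P k) ⟩
    sumList (λ d → 𝟙 (d ==ᶜ c) * extensions c) (chains P k)
      ≡⟨ trans (sumList-cong (λ d → *-comm (𝟙 (d ==ᶜ c)) (extensions c)) (chains P k)) (sumList-*ˡ (extensions c) _ (chains P k)) ⟩
    extensions c * sumList (λ d → 𝟙 (d ==ᶜ c)) (chains P k)
      ≡⟨ cong (extensions c *_) (count-chains k c) ⟩
    extensions c * 𝟙 (isChain c)
      ≡⟨ cong (_* 𝟙 (isChain c)) extensions-c ⟩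
    𝟙 (isIdeal P a) * 𝟙 (a ⊊ᵇ head c) * 𝟙 (isChain c)
      ≡⟨ *-assoc (𝟙 (isIdeal P a)) _ _ ⟩
    𝟙 (isIdeal P a) * (𝟙 (a ⊊ᵇ head c) * 𝟙 (isChain c))
      ≡⟨ cong (𝟙 (isIdeal P a) *_) (𝟙-∧ (a ⊊ᵇ head c) (isChain c)) ⟨
    𝟙 (isIdeal P a) * 𝟙 ((a ⊊ᵇ head c) ∧ isChain c)
      ≡⟨ 𝟙-∧ (isIdeal P a) _ ⟨
    𝟙 (isChain (a ∷ c)) ∎
    where
    open ≡-Reasoning
    below : Vec (Subset n) (suc k) → List (Subset n)
    below d = filterᵇ (_⊊ᵇ head d) (J P)
    extensions : Vec (Subset n) (suc k) → ℕ
    extensions d = sumList (λ I → 𝟙 (I ⊊ᵇ head d) * 𝟙 (I ==ˢ a)) (J P)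
    factor : ∀ d I → 𝟙 (I ⊊ᵇ head d) * 𝟙 ((I ∷ d) ==ᶜ (a ∷ c)) ≡ 𝟙 (d ==ᶜ c) * (𝟙 (I ⊊ᵇ head d) * 𝟙 (I ==ˢ a))
    factor d I rewrite eqᵇ-∷ (≡-dec Bool._≟_) I a d c with d ==ᶜ c
    ... | true = trans (cong (λ z → 𝟙 (I ⊊ᵇ head d) * 𝟙 z) (Bool.∧-identityʳ (I ==ˢ a))) (sym (+-identityʳ _))
    ... | false = trans (cong (λ z → 𝟙 (I ⊊ᵇ head d) * 𝟙 z) (Bool.∧-zeroʳ (I ==ˢ a))) (*-zeroʳ (𝟙 (I ⊊ᵇ head d)))
    only-c : ∀ d → 𝟙 (d ==ᶜ c) * extensions d ≡ 𝟙 (d ==ᶜ c) * extensions c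
    only-c d with d ==ᶜ c in eq
    ... | true = cong (λ z → 1 * extensions z) (eqᵇ-sound (≡-dec (≡-dec Bool._≟_)) (≡→T eq))
    ... | false = refl
    extensions-c : extensions c ≡ 𝟙 (isIdeal P a) * 𝟙 (a ⊊ᵇ head c)
    extensions-c = trans (sumList-cong (λ I → *-comm (𝟙 (I ⊊ᵇ head c)) (𝟙 (I ==ˢ a))) (J P))
      (trans (sumList-count (≡-dec Bool._≟_) (λ I → 𝟙 (I ⊊ᵇ head c)) a (J P)) (cong (_* 𝟙 (a ⊊ᵇ head c)) (count-J a)))

  -- Chains as rank functions

  ≼-sound : ∀ {x y} → T (le P x y) → x ≼ y
  ≼-sound {x} {y} = toWitness {a? = x ≼? y}

  ≼-complete : ∀ {x y} → x ≼ y → T (le P x y)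
  ≼-complete {x} {y} = fromWitness {a? = x ≼? y}

  isIdeal⁻ : ∀ I → T (isIdeal P I) → ∀ x y → y ≼ x → T (lookup I x) → T (lookup I y)
  isIdeal⁻ I h x y yx ix with T∨⁻ {not (le P y x ∧ lookup I x)} (all-allFin⁻ _ (all-allFin⁻ _ h x) y)
  ... | inj₁ a = ⊥-elim (Tnot⁻ a (T∧ (≼-complete yx) ix))
  ... | inj₂ b = b

  isIdeal⁺ : ∀ I → (∀ x y → y ≼ x → T (lookup I x) → T (lookup I y)) → T (isIdeal P I)
  isIdeal⁺ I h = all-allFin⁺ _ (λ x → all-allFin⁺ _ (λ y → closed x y))
    where
    closed : ∀ x y → T (not (le P y x ∧ lookup I x) ∨ lookup I y)
    closed x y with le P y x in e1 | lookup I x in e2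
    ... | false | _ = tt
    ... | true | false = tt
    ... | true | true = h x y (≼-sound (≡→T e1)) (≡→T e2)

  ⊊ᵇ⇒⊆ : ∀ (I K : Subset n) → T (I ⊊ᵇ K) → ∀ x → T (lookup I x) → T (lookup K x)
  ⊊ᵇ⇒⊆ I K h x ix with T∨⁻ {not (lookup I x)} (all-allFin⁻ (λ y → not (lookup I y) ∨ lookup K y) (T∧₁ {all (λ y → not (lookup I y) ∨ lookup K y) (allFin n)} h) x)
  ... | inj₁ a = ⊥-elim (Tnot⁻ a ix)
  ... | inj₂ b = b

  ⊊ᵇ⇒∃∉ : ∀ (I K : Subset n) → T (I ⊊ᵇ K) → ∃ λ x → T (lookup K x) × ¬ T (lookup I x)
  ⊊ᵇ⇒∃∉ I K h with any-allFin⁻ _ (T∧₂ {all (λ x → not (lookup I x) ∨ lookup K x) (allFin n)} h)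
  ... | x , t = x , T∧₁ t , Tnot⁻ (T∧₂ {lookup K x} t)

  ⊊ᵇ⁺ : ∀ (I K : Subset n) → (∀ x → T (lookup I x) → T (lookup K x)) → ∀ x → T (lookup K x) → ¬ T (lookup I x) → T (I ⊊ᵇ K)
  ⊊ᵇ⁺ I K sub x kx nix = T∧ (all-allFin⁺ _ included) (any-allFin⁺ (λ y → lookup K y ∧ not (lookup I y)) x (T∧ kx (Tnot nix)))
    where
    included : ∀ y → T (not (lookup I y) ∨ lookup K y)
    included y with lookup I y in e
    ... | false = tt
    ... | true = sub y (≡→T e)

  isMonotone : Vec ℕ n → Bool
  isMonotone f = all (λ x → all (λ y → not (le P x y) ∨ (lookup f x ≤ᵇ lookup f y)) (allFin n)) (allFin n)

  Monotone : Vec ℕ n → Set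
  Monotone f = ∀ x y → x ≼ y → lookup f x ≤ lookup f y

  isMonotone⁻ : ∀ f → T (isMonotone f) → Monotone f
  isMonotone⁻ f h x y xy with T∨⁻ {not (le P x y)} (all-allFin⁻ _ (all-allFin⁻ _ h x) y)
  ... | inj₁ a = ⊥-elim (Tnot⁻ a (≼-complete xy))
  ... | inj₂ b = ≤ᵇ⇒≤ _ _ b

  isMonotone⁺ : ∀ f → Monotone f → T (isMonotone f)
  isMonotone⁺ f h = all-allFin⁺ _ (λ x → all-allFin⁺ _ (λ y → pair x y))
    where
    pair : ∀ x y → T (not (le P x y) ∨ (lookup f x ≤ᵇ lookup f y))
    pair x y with le P x y in eq
    ... | false = tt
    ... | true = ≤⇒≤ᵇ (h x y (≼-sound (≡→T eq)))

  hits : Vec ℕ n → ℕ → Bool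
  hits f j = any (λ x → lookup f x ==ℕ j) (allFin n)

  hits⁻ : ∀ f j → T (hits f j) → ∃ λ x → lookup f x ≡ j
  hits⁻ f j h with any-allFin⁻ _ h
  ... | x , t = x , eqᵇ-sound _≟_ t

  hits⁺ : ∀ f x → T (hits f (lookup f x))
  hits⁺ f x = any-allFin⁺ (λ y → lookup f y ==ℕ lookup f x) x (eqᵇ-refl _≟_ (lookup f x))

  -- With c_t = {x | f x ≤ t}, attaining the value i is the strictness of cᵢ₋₁ ⊊ cᵢ.
  encodesChain : ℕ → Vec ℕ n → Bool
  encodesChain k f = boundedBy (suc k) f ∧ isMonotone f ∧ allRange 1 k (hits f)

  sublevel : ℕ → Vec ℕ n → Subset n
  sublevel t f = Vec.map (_≤ᵇ t) f

  lookup-sublevel : ∀ t f x → lookup (sublevel t f) x ≡ (lookup f x ≤ᵇ t)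
  lookup-sublevel t f x = lookup-map x (_≤ᵇ t) f

  sublevels : ℕ → (L : ℕ) → Vec ℕ n → Vec (Subset n) L
  sublevels s zero f = []
  sublevels s (suc L) f = sublevel s f ∷ sublevels (suc s) L f

  lookup-sublevels : ∀ s L f (t : Fin L) → lookup (sublevels s L f) t ≡ sublevel (s + toℕ t) f
  lookup-sublevels s (suc L) f zero = cong (λ z → sublevel z f) (sym (+-identityʳ s))
  lookup-sublevels s (suc L) f (suc t) = trans (lookup-sublevels (suc s) L f t) (cong (λ z → sublevel z f) (sym (+-suc s (toℕ t))))

  sublevel-isIdeal : ∀ t f → Monotone f → T (isIdeal P (sublevel t f))
  sublevel-isIdeal t f mono = isIdeal⁺ (sublevel t f) (λ x y yx tx →
    subst T (sym (lookup-sublevel t f y)) (≤⇒≤ᵇ (≤-trans (mono y x yx) (≤ᵇ⇒≤ _ _ (subst T (lookup-sublevel t f x) tx)))))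

  missCount : ∀ {L} → Vec (Subset n) L → Fin n → ℕ
  missCount [] x = 0
  missCount (c ∷ cs) x = 𝟙 (not (lookup c x)) + missCount cs x

  rank : ∀ {L} → Vec (Subset n) L → Vec ℕ n
  rank c = tabulate (missCount c)

  missCount≤ : ∀ {L} (c : Vec (Subset n) L) x → missCount c x ≤ L
  missCount≤ [] x = z≤n
  missCount≤ (c ∷ cs) x = +-mono-≤ (𝟙≤1 (not (lookup c x))) (missCount≤ cs x)

  rank-bounded : ∀ {L} (c : Vec (Subset n) L) → T (boundedBy L (rank c))
  rank-bounded {L} c = boundedBy⁺ L (rank c) (λ x → subst (_≤ L) (sym (lookup∘tabulate (missCount c) x)) (missCount≤ c x))

  chain-isSublevel : ∀ {m} (c : Vec (Subset n) (suc m)) → T (isChain c) →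
    ∀ (t : Fin (suc m)) x → lookup (lookup c t) x ≡ (missCount c x ≤ᵇ toℕ t)
  chain-isSublevel {zero} (c₀ ∷ []) h zero x with lookup c₀ x
  ... | true = refl
  ... | false = refl
  chain-isSublevel {suc m} (c₀ ∷ cs@(c₁ ∷ _)) h t x = go t
    where
    ih = chain-isSublevel cs (T∧₂ {c₀ ⊊ᵇ c₁} (T∧₂ {isIdeal P c₀} h))
    in-later : T (lookup c₀ x) → missCount cs x ≡ 0
    in-later t₀ = n≤0⇒n≡0 (≤ᵇ⇒≤ (missCount cs x) 0 (subst T (ih zero x) (⊊ᵇ⇒⊆ c₀ c₁ (T∧₁ {c₀ ⊊ᵇ c₁} (T∧₂ {isIdeal P c₀} h)) x t₀)))
    go : ∀ t → lookup (lookup (c₀ ∷ cs) t) x ≡ (missCount (c₀ ∷ cs) x ≤ᵇ toℕ t)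
    go zero with lookup c₀ x in e
    ... | true rewrite in-later (≡→T e) = refl
    ... | false = refl
    go (suc t′) with lookup c₀ x in e
    ... | true rewrite in-later (≡→T e) = trans (ih t′ x) (cong (_≤ᵇ toℕ t′) (in-later (≡→T e)))
    ... | false = trans (ih t′ x) (sym (≤ᵇ-suc (missCount cs x) (toℕ t′)))

  chain-head-missCount : ∀ {m} (c : Vec (Subset n) (suc m)) → T (isChain c) → ∀ x → T (lookup (head c) x) → missCount c x ≡ 0
  chain-head-missCount c h x t = n≤0⇒n≡0 (≤ᵇ⇒≤ _ 0 (subst T (chain-isSublevel c h zero x) (subst (λ z → T (lookup z x)) (head≡lookup c) t)))
    where
    head≡lookup : ∀ {m} (c : Vec (Subset n) (suc m)) → head c ≡ lookup c zero
    head≡lookup (_ ∷ _) = refl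

  chain≡sublevels-rank : ∀ {m} (c : Vec (Subset n) (suc m)) → T (isChain c) → c ≡ sublevels 0 (suc m) (rank c)
  chain≡sublevels-rank c h = lookup-ext c _ (λ t → sym (trans (lookup-sublevels 0 _ (rank c) t) (lookup-ext _ _ (λ x →
    trans (lookup-sublevel (toℕ t) (rank c) x) (trans (cong (_≤ᵇ toℕ t) (lookup∘tabulate (missCount c) x)) (sym (chain-isSublevel c h t x)))))))

  rank-monotone : ∀ {m} (c : Vec (Subset n) (suc m)) → T (isChain c) → Monotone (rank c)
  rank-monotone c h x y xy = subst₂ _≤_ (sym (lookup∘tabulate (missCount c) x)) (sym (lookup∘tabulate (missCount c) y)) (go c h)
    where
    step : ∀ c₀ → T (isIdeal P c₀) → 𝟙 (not (lookup c₀ x)) ≤ 𝟙 (not (lookup c₀ y))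
    step c₀ i with lookup c₀ y in ey | lookup c₀ x in ex
    ... | false | _ = 𝟙≤1 _
    ... | true | true = z≤n
    ... | true | false = ⊥-elim (subst T ex (isIdeal⁻ c₀ i y x xy (≡→T ey)))
    go : ∀ {m} (c : Vec (Subset n) (suc m)) → T (isChain c) → missCount c x ≤ missCount c y
    go {zero} (c₀ ∷ []) h = +-mono-≤ (step c₀ h) z≤n
    go {suc m} (c₀ ∷ cs@(c₁ ∷ _)) h = +-mono-≤ (step c₀ (T∧₁ h)) (go cs (T∧₂ {c₀ ⊊ᵇ c₁} (T∧₂ {isIdeal P c₀} h)))

  chain-missCount-hits : ∀ {m} (c : Vec (Subset n) (suc m)) → T (isChain c) → ∀ j → 1 ≤ j → j ≤ m → ∃ λ x → missCount c x ≡ j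
  chain-missCount-hits {zero} c h j 1≤j j≤0 = ⊥-elim (<-irrefl refl (≤-trans 1≤j j≤0))
  chain-missCount-hits {suc m} (c₀ ∷ cs@(c₁ ∷ _)) h = go
    where
    c₀⊊c₁ : T (c₀ ⊊ᵇ c₁)
    c₀⊊c₁ = T∧₁ {c₀ ⊊ᵇ c₁} (T∧₂ {isIdeal P c₀} h)
    tail-chain : T (isChain cs)
    tail-chain = T∧₂ {c₀ ⊊ᵇ c₁} (T∧₂ {isIdeal P c₀} h)
    go : ∀ j → 1 ≤ j → j ≤ suc m → ∃ λ x → missCount (c₀ ∷ cs) x ≡ j
    go (suc zero) _ _ with ⊊ᵇ⇒∃∉ c₀ c₁ c₀⊊c₁
    ... | x , x∈c₁ , x∉c₀ = x , cong₂ _+_ (cong (𝟙 ∘ not) (¬T→≡ x∉c₀)) (chain-head-missCount cs tail-chain x x∈c₁)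
    go (suc (suc j)) _ (s≤s j≤m) with chain-missCount-hits cs tail-chain (suc j) (s≤s z≤n) j≤m
    ... | x , e = x , cong₂ _+_ (cong (𝟙 ∘ not) (¬T→≡ x∉c₀)) e
      where
      x∉c₀ : ¬ T (lookup c₀ x)
      x∉c₀ t = <-irrefl (sym (chain-head-missCount cs tail-chain x (⊊ᵇ⇒⊆ c₀ c₁ c₀⊊c₁ x t))) (subst (0 <_) (sym e) (s≤s z≤n))

  rank-encodesChain : ∀ k (c : Vec (Subset n) (suc k)) → T (isChain c) → T (encodesChain k (rank c))
  rank-encodesChain k c h = T∧ (rank-bounded c) (T∧ (isMonotone⁺ (rank c) (rank-monotone c h)) (allRange⁺ 1 k (hits (rank c)) attained))
    where
    attained : ∀ t → 1 ≤ t → t < 1 + k → T (hits (rank c) t)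
    attained t 1≤t t≤k with chain-missCount-hits c h t 1≤t (≤-pred t≤k)
    ... | x , e = subst (T ∘ hits (rank c)) (trans (lookup∘tabulate (missCount c) x) e) (hits⁺ (rank c) x)

  missCount-sublevels : ∀ s L f x → missCount (sublevels s L f) x ≡ (lookup f x ∸ s) ⊓ L
  missCount-sublevels s zero f x = sym (⊓-zeroʳ _)
  missCount-sublevels s (suc L) f x rewrite lookup-sublevel s f x | missCount-sublevels (suc s) L f x with lookup f x ≤? s
  ... | yes fs rewrite T→≡ (≤⇒≤ᵇ fs) | m≤n⇒m∸n≡0 fs | m≤n⇒m∸n≡0 (m≤n⇒m≤1+n fs) = refl
  ... | no nfs rewrite ¬T→≡ (λ t → nfs (≤ᵇ⇒≤ (lookup f x) s t)) | ∸-sucʳ (lookup f x) s (≰⇒> nfs) = refl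

  rank-sublevels : ∀ K f → T (boundedBy K f) → rank (sublevels 0 K f) ≡ f
  rank-sublevels K f b = lookup-ext _ _ (λ x → trans (lookup∘tabulate (missCount (sublevels 0 K f)) x)
    (trans (missCount-sublevels 0 K f x) (m≤n⇒m⊓n≡m (boundedBy⁻ K f b x))))

  sublevels-isChain : ∀ s L f → Monotone f → (∀ t → s < t → t ≤ s + L → T (hits f t)) → T (isChain (sublevels s (suc L) f))
  sublevels-isChain s zero f mono hs = sublevel-isIdeal s f mono
  sublevels-isChain s (suc L) f mono hs = T∧ (sublevel-isIdeal s f mono) (T∧ strict
    (sublevels-isChain (suc s) L f mono (λ t st tl → hs t (<-trans (n<1+n s) st) (≤-trans tl (≤-reflexive (sym (+-suc s L)))))))
    where
    w = hits⁻ f (suc s) (hs (suc s) (n<1+n s) (≤-trans (s≤s (m≤m+n s L)) (≤-reflexive (sym (+-suc s L)))))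
    strict : T (sublevel s f ⊊ᵇ sublevel (suc s) f)
    strict = ⊊ᵇ⁺ (sublevel s f) (sublevel (suc s) f)
      (λ x t → subst T (sym (lookup-sublevel (suc s) f x)) (≤⇒≤ᵇ (m≤n⇒m≤1+n (≤ᵇ⇒≤ (lookup f x) s (subst T (lookup-sublevel s f x) t)))))
      (proj₁ w)
      (subst T (sym (lookup-sublevel (suc s) f (proj₁ w))) (≤⇒≤ᵇ (≤-reflexive (proj₂ w))))
      (λ t → <-irrefl refl (subst (_≤ s) (proj₂ w) (≤ᵇ⇒≤ _ _ (subst T (lookup-sublevel s f (proj₁ w)) t))))

  encodesChain⇒isChain : ∀ k f → T (encodesChain k f) → T (isChain (sublevels 0 (suc k) f))
  encodesChain⇒isChain k f g = sublevels-isChain 0 k f (isMonotone⁻ f (T∧₁ (T∧₂ {boundedBy (suc k) f} g)))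
    (λ t 0<t t≤k → allRange⁻ 1 k (hits f) (T∧₂ {isMonotone f} (T∧₂ {boundedBy (suc k) f} g)) t 0<t (s≤s t≤k))

  rank-correspondence : ∀ k f (c : Vec (Subset n) (suc k)) → T (isChain c) →
    (f ==ᵛ rank c) ≡ (c ==ᶜ sublevels 0 (suc k) f) ∧ encodesChain k f
  rank-correspondence k f c h = T⇔⇒≡ to from
    where
    to : T (f ==ᵛ rank c) → T ((c ==ᶜ sublevels 0 (suc k) f) ∧ encodesChain k f)
    to t = T∧ (eqᵇ-complete (≡-dec (≡-dec Bool._≟_)) (trans (chain≡sublevels-rank c h) (cong (sublevels 0 (suc k)) (sym f≡))))
              (subst (T ∘ encodesChain k) (sym f≡) (rank-encodesChain k c h))
      where f≡ = eqᵇ-sound (≡-dec _≟_) t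
    from : T ((c ==ᶜ sublevels 0 (suc k) f) ∧ encodesChain k f) → T (f ==ᵛ rank c)
    from t = eqᵇ-complete (≡-dec _≟_) (trans (sym (rank-sublevels (suc k) f (T∧₁ (T∧₂ {c ==ᶜ sublevels 0 (suc k) f} t))))
      (cong rank (sym (eqᵇ-sound (≡-dec (≡-dec Bool._≟_)) (T∧₁ {c ==ᶜ sublevels 0 (suc k) f} t)))))

  sumList-chains : ∀ k (G : Vec (Subset n) (suc k) → ℕ) →
    sumList G (chains P k) ≡ sumBounded n (suc k) (λ f → 𝟙 (encodesChain k f) * G (sublevels 0 (suc k) f))
  sumList-chains k G = begin
    sumList G (chains P k)
      ≡⟨ sumList-cong (λ c → sym (trans (sumBounded-pick n K (λ _ → G c) (rank c))
           (trans (cong (λ z → 𝟙 z * G c) (T→≡ (rank-bounded c))) (+-identityʳ (G c))))) (chains P k) ⟩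
    sumList (λ c → sumBounded n K (λ f → 𝟙 (f ==ᵛ rank c) * G c)) (chains P k)
      ≡⟨ sumList-swapBounded n K (λ c f → 𝟙 (f ==ᵛ rank c) * G c) (chains P k) ⟩
    sumBounded n K (λ f → sumList (λ c → 𝟙 (f ==ᵛ rank c) * G c) (chains P k))
      ≡⟨ sumBounded-cong n K (λ f _ → chains-with-rank f) ⟩
    sumBounded n K (λ f → 𝟙 (encodesChain k f) * G (sublevels 0 K f)) ∎
    where
    open ≡-Reasoning
    K = suc k
    pointwise : ∀ f c → T (isChain c) →
      𝟙 (f ==ᵛ rank c) * G c ≡ 𝟙 (c ==ᶜ sublevels 0 K f) * (𝟙 (encodesChain k f) * G (sublevels 0 K f))
    pointwise f c h rewrite rank-correspondence k f c h with c ==ᶜ sublevels 0 K f in e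
    ... | false = refl
    ... | true = subst (λ d → 𝟙 (encodesChain k f) * G d ≡ 1 * (𝟙 (encodesChain k f) * G (sublevels 0 K f)))
                   (sym (eqᵇ-sound (≡-dec (≡-dec Bool._≟_)) (≡→T e))) (sym (+-identityʳ _))
    chains-with-rank : ∀ f → sumList (λ c → 𝟙 (f ==ᵛ rank c) * G c) (chains P k) ≡ 𝟙 (encodesChain k f) * G (sublevels 0 K f)
    chains-with-rank f = trans (sumList-congᴬ (chains P k) (All.map (λ {c} → pointwise f c) (all-chains-isChain k)))
      (trans (sumList-count (≡-dec (≡-dec Bool._≟_)) (λ _ → 𝟙 (encodesChain k f) * G (sublevels 0 K f)) (sublevels 0 K f) (chains P k))
      (trans (cong (_* (𝟙 (encodesChain k f) * G (sublevels 0 K f))) (count-chains k (sublevels 0 K f))) counted))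
      where
      counted : 𝟙 (isChain (sublevels 0 K f)) * (𝟙 (encodesChain k f) * G (sublevels 0 K f)) ≡ 𝟙 (encodesChain k f) * G (sublevels 0 K f)
      counted with encodesChain k f in e
      ... | false = *-zeroʳ (𝟙 (isChain (sublevels 0 K f)))
      ... | true rewrite T→≡ (encodesChain⇒isChain k f (≡→T e)) = +-identityʳ _

  occursIn : ∀ {L} → Vec (Subset n) L → Subset n → Bool
  occursIn c I = any (_==ˢ I) (toList c)

  ∈-sublevels : ∀ s L f {x} → x ∈ toList (sublevels s L f) → ∃ λ t → s ≤ t × t < s + L × x ≡ sublevel t f
  ∈-sublevels s (suc L) f (here refl) = s , ≤-refl , m<m+n s (s≤s z≤n) , refl
  ∈-sublevels s (suc L) f (there m) with ∈-sublevels (suc s) L f m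
  ... | t , st , tl , e = t , ≤-trans (n≤1+n s) st , ≤-trans tl (≤-reflexive (sym (+-suc s L))) , e

  sumList-occursIn-sublevels : ∀ (φ : Subset n → Bool) f → Monotone f → ∀ s L → (∀ t → s < t → t < s + L → T (hits f t)) →
    sumList (λ I → 𝟙 (φ I) * 𝟙 (occursIn (sublevels s L f) I)) (J P) ≡ sumRange s L (λ t → 𝟙 (φ (sublevel t f)))
  sumList-occursIn-sublevels φ f mono s zero hs = trans (sumList-cong (λ I → *-zeroʳ (𝟙 (φ I))) (J P)) (sumList-0 (J P))
  sumList-occursIn-sublevels φ f mono s (suc L) hs = begin
    sumList (λ I → 𝟙 (φ I) * 𝟙 (occursIn (sublevels s (suc L) f) I)) (J P)
      ≡⟨ sumList-cong split (J P) ⟩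
    sumList (λ I → 𝟙 (I ==ˢ sublevel s f) * 𝟙 (φ I) + 𝟙 (φ I) * 𝟙 (occursIn (sublevels (suc s) L f) I)) (J P)
      ≡⟨ sumList-+ _ _ (J P) ⟩
    sumList (λ I → 𝟙 (I ==ˢ sublevel s f) * 𝟙 (φ I)) (J P) + sumList (λ I → 𝟙 (φ I) * 𝟙 (occursIn (sublevels (suc s) L f) I)) (J P)
      ≡⟨ cong₂ _+_ first (sumList-occursIn-sublevels φ f mono (suc s) L
           (λ t st tl → hs t (<-trans (n<1+n s) st) (≤-trans tl (≤-reflexive (sym (+-suc s L)))))) ⟩
    𝟙 (φ (sublevel s f)) + sumRange (suc s) L (λ t → 𝟙 (φ (sublevel t f))) ∎
    where
    open ≡-Reasoning
    first : sumList (λ I → 𝟙 (I ==ˢ sublevel s f) * 𝟙 (φ I)) (J P) ≡ 𝟙 (φ (sublevel s f))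
    first = trans (sumList-count (≡-dec Bool._≟_) (λ I → 𝟙 (φ I)) (sublevel s f) (J P))
      (trans (cong (_* 𝟙 (φ (sublevel s f))) (count-J (sublevel s f)))
      (trans (cong (λ z → 𝟙 z * 𝟙 (φ (sublevel s f))) (T→≡ (sublevel-isIdeal s f mono))) (+-identityʳ _)))
    -- the values s + 1, …, s + L ∸ 1 are attained, so no later sublevel set equals sublevel s f
    not-later : ∀ I → T (I ==ˢ sublevel s f) → ¬ T (occursIn (sublevels (suc s) L f) I)
    not-later I e a with find (Any.any⁻ (_==ˢ I) (toList (sublevels (suc s) L f)) a)
    ... | K , m , K≡I with ∈-sublevels (suc s) L f m
    ... | t , st , tl , refl = distinct (trans (eqᵇ-sound (≡-dec Bool._≟_) K≡I) (eqᵇ-sound (≡-dec Bool._≟_) e))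
      where
      w = hits⁻ f t (hs t st (≤-trans tl (≤-reflexive (sym (+-suc s L)))))
      distinct : sublevel t f ≢ sublevel s f
      distinct eq = <-irrefl refl (≤-trans st (subst (_≤ s) (proj₂ w) fx≤s))
        where
        fx≤s : lookup f (proj₁ w) ≤ s
        fx≤s = ≤ᵇ⇒≤ _ _ (subst T (lookup-sublevel s f (proj₁ w)) (subst (λ z → T (lookup z (proj₁ w))) eq
          (subst T (sym (lookup-sublevel t f (proj₁ w))) (≤⇒≤ᵇ (≤-reflexive (proj₂ w))))))
    split : ∀ I → 𝟙 (φ I) * 𝟙 (occursIn (sublevels s (suc L) f) I)
                ≡ 𝟙 (I ==ˢ sublevel s f) * 𝟙 (φ I) + 𝟙 (φ I) * 𝟙 (occursIn (sublevels (suc s) L f) I)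
    split I with I ==ˢ sublevel s f in e
    ... | false rewrite eqᵇ-sym (≡-dec Bool._≟_) (sublevel s f) I | e = refl
    ... | true rewrite eqᵇ-sym (≡-dec Bool._≟_) (sublevel s f) I | e | ¬T→≡ (not-later I (≡→T e)) =
      trans (*-identityʳ (𝟙 (φ I))) (sym (trans (cong₂ _+_ (*-identityˡ (𝟙 (φ I))) (*-zeroʳ (𝟙 (φ I)))) (+-identityʳ _)))

  chainTotal-by-codes : ∀ k φ → chainTotal k φ ≡ sumBounded n (suc k) (λ f → 𝟙 (encodesChain k f) * sumRange 0 (suc k) (λ t → 𝟙 (φ (sublevel t f))))
  chainTotal-by-codes k φ = begin
    sumList (λ I → 𝟙 (φ I) * chainsThrough P k I) (J P)
      ≡⟨ sumList-cong (λ I → cong (𝟙 (φ I) *_) (length-filterᵇ (λ c → occursIn c I) (chains P k))) (J P) ⟩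
    sumList (λ I → 𝟙 (φ I) * sumList (λ c → 𝟙 (occursIn c I)) (chains P k)) (J P)
      ≡⟨ sumList-cong (λ I → sym (sumList-*ˡ (𝟙 (φ I)) (λ c → 𝟙 (occursIn c I)) (chains P k))) (J P) ⟩
    sumList (λ I → sumList (λ c → 𝟙 (φ I) * 𝟙 (occursIn c I)) (chains P k)) (J P)
      ≡⟨ sumList-swap (λ I c → 𝟙 (φ I) * 𝟙 (occursIn c I)) (J P) (chains P k) ⟩
    sumList (λ c → sumList (λ I → 𝟙 (φ I) * 𝟙 (occursIn c I)) (J P)) (chains P k)
      ≡⟨ sumList-chains k _ ⟩
    sumBounded n (suc k) (λ f → 𝟙 (encodesChain k f) * sumList (λ I → 𝟙 (φ I) * 𝟙 (occursIn (sublevels 0 (suc k) f) I)) (J P))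
      ≡⟨ sumBounded-cong n (suc k) (λ f _ → on-codes f) ⟩
    sumBounded n (suc k) (λ f → 𝟙 (encodesChain k f) * sumRange 0 (suc k) (λ t → 𝟙 (φ (sublevel t f)))) ∎
    where
    open ≡-Reasoning
    on-codes : ∀ f → 𝟙 (encodesChain k f) * sumList (λ I → 𝟙 (φ I) * 𝟙 (occursIn (sublevels 0 (suc k) f) I)) (J P)
                   ≡ 𝟙 (encodesChain k f) * sumRange 0 (suc k) (λ t → 𝟙 (φ (sublevel t f)))
    on-codes f with encodesChain k f in e
    ... | false = refl
    ... | true = cong (_+ 0) (sumList-occursIn-sublevels φ f (isMonotone⁻ f (T∧₁ (T∧₂ {boundedBy (suc k) f} g))) 0 (suc k)
           (λ t 0<t t≤k → allRange⁻ 1 k (hits f) (T∧₂ {isMonotone f} (T∧₂ {boundedBy (suc k) f} g)) t 0<t t≤k))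
      where g = ≡→T e

  -- Toggles at a fixed element p

  module _ (p : Fin n) where

    isBelow : Fin n → Bool
    isBelow q = le P q p ∧ not (eqF P q p)

    isAbove : Fin n → Bool
    isAbove q = le P p q ∧ not (eqF P q p)

    maxBelowIn : Vec ℕ n → List (Fin n) → ℕ
    maxBelowIn f [] = 0
    maxBelowIn f (q ∷ L) = (if isBelow q then lookup f q else 0) ⊔ maxBelowIn f L

    minAboveIn : ℕ → Vec ℕ n → List (Fin n) → ℕ
    minAboveIn B f [] = B
    minAboveIn B f (q ∷ L) = if isAbove q then lookup f q ⊓ minAboveIn B f L else minAboveIn B f L

    -- f(p) ranges over [maxBelow f, minAbove B f] among the monotone B-bounded changes of f at p
    maxBelow : Vec ℕ n → ℕ
    maxBelow f = maxBelowIn f (allFin n)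

    minAbove : ℕ → Vec ℕ n → ℕ
    minAbove B f = minAboveIn B f (allFin n)

    minAboveIn≤ : ∀ B f L → minAboveIn B f L ≤ B
    minAboveIn≤ B f [] = ≤-refl
    minAboveIn≤ B f (q ∷ L) with isAbove q
    ... | true = ≤-trans (m⊓n≤n _ _) (minAboveIn≤ B f L)
    ... | false = minAboveIn≤ B f L

    togglePlus-sublevelIn : ∀ t f L →
      all (λ q → not (le P q p ∧ not (eqF P q p) ∧ not (lookup (sublevel t f) q))) L ≡ (maxBelowIn f L ≤ᵇ t)
    togglePlus-sublevelIn t f [] = refl
    togglePlus-sublevelIn t f (q ∷ L)
      rewrite lookup-sublevel t f q | togglePlus-sublevelIn t f L | ⊔-≤ᵇ (if isBelow q then lookup f q else 0) (maxBelowIn f L) t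
      with le P q p | eqF P q p
    ... | false | _ = refl
    ... | true | true = refl
    ... | true | false rewrite Bool.not-involutive (lookup f q ≤ᵇ t) = refl

    toggleMinus-sublevelIn : ∀ B t f → t < B → ∀ L →
      all (λ q → not (le P p q ∧ not (eqF P q p) ∧ lookup (sublevel t f) q)) L ≡ not (minAboveIn B f L ≤ᵇ t)
    toggleMinus-sublevelIn B t f tB [] = sym (cong not (¬T→≡ (λ h → <-irrefl refl (≤-trans tB (≤ᵇ⇒≤ B t h)))))
    toggleMinus-sublevelIn B t f tB (q ∷ L) rewrite lookup-sublevel t f q | toggleMinus-sublevelIn B t f tB L
      with le P p q | eqF P q p
    ... | false | _ = refl
    ... | true | true = refl
    ... | true | false rewrite ⊓-≤ᵇ (lookup f q) (minAboveIn B f L) t with lookup f q ≤ᵇ t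
    ...   | true = refl
    ...   | false = refl

    count-togglePlus : ∀ K f → lookup f p ≤ K → sumRange 0 K (λ t → 𝟙 (togglePlus P p (sublevel t f))) ≡ lookup f p ∸ maxBelow f
    count-togglePlus K f fK = trans (sumRange-cong 0 K (λ t _ _ → cong 𝟙 (pointwise t))) (count-between (maxBelow f) (lookup f p) K fK)
      where
      pointwise : ∀ t → togglePlus P p (sublevel t f) ≡ (maxBelow f ≤ᵇ t) ∧ not (lookup f p ≤ᵇ t)
      pointwise t rewrite lookup-sublevel t f p | togglePlus-sublevelIn t f (allFin n) =
        Bool.∧-comm (not (lookup f p ≤ᵇ t)) (maxBelow f ≤ᵇ t)

    count-toggleMinus : ∀ K f → sumRange 0 K (λ t → 𝟙 (toggleMinus P p (sublevel t f))) ≡ minAbove K f ∸ lookup f p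
    count-toggleMinus K f =
      trans (sumRange-cong 0 K (λ t _ tK → cong 𝟙 (pointwise t tK))) (count-between (lookup f p) (minAbove K f) K (minAboveIn≤ K f (allFin n)))
      where
      pointwise : ∀ t → t < K → toggleMinus P p (sublevel t f) ≡ (lookup f p ≤ᵇ t) ∧ not (minAbove K f ≤ᵇ t)
      pointwise t tK rewrite lookup-sublevel t f p | toggleMinus-sublevelIn K t f tK (allFin n) = refl

    chainTotal-togglePlus : ∀ k →
      chainTotal k (togglePlus P p) ≡ sumBounded n (suc k) (λ f → 𝟙 (encodesChain k f) * (lookup f p ∸ maxBelow f))
    chainTotal-togglePlus k = trans (chainTotal-by-codes k (togglePlus P p))
      (sumBounded-cong n (suc k) (λ f b → cong (𝟙 (encodesChain k f) *_) (count-togglePlus (suc k) f (boundedBy⁻ (suc k) f b p))))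

    chainTotal-toggleMinus : ∀ k →
      chainTotal k (toggleMinus P p) ≡ sumBounded n (suc k) (λ f → 𝟙 (encodesChain k f) * (minAbove (suc k) f ∸ lookup f p))
    chainTotal-toggleMinus k = trans (chainTotal-by-codes k (toggleMinus P p))
      (sumBounded-cong n (suc k) (λ f b → cong (𝟙 (encodesChain k f) *_) (count-toggleMinus (suc k) f)))

    eqF-sound : ∀ {x y} → T (eqF P x y) → x ≡ y
    eqF-sound {x} {y} = toWitness {a? = x Fin.≟ y}

    eqF-complete : ∀ {x y} → x ≡ y → T (eqF P x y)
    eqF-complete {x} {y} = fromWitness {a? = x Fin.≟ y}

    isBelow⁻ : ∀ {q} → T (isBelow q) → q ≼ p × q ≢ p
    isBelow⁻ {q} h = ≼-sound (T∧₁ h) , (λ e → Tnot⁻ (T∧₂ {le P q p} h) (eqF-complete e))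

    isBelow⁺ : ∀ {q} → q ≼ p → q ≢ p → T (isBelow q)
    isBelow⁺ qp ne = T∧ (≼-complete qp) (Tnot (ne ∘ eqF-sound))

    isAbove⁻ : ∀ {q} → T (isAbove q) → p ≼ q × q ≢ p
    isAbove⁻ {q} h = ≼-sound (T∧₁ h) , (λ e → Tnot⁻ (T∧₂ {le P p q} h) (eqF-complete e))

    isAbove⁺ : ∀ {q} → p ≼ q → q ≢ p → T (isAbove q)
    isAbove⁺ pq ne = T∧ (≼-complete pq) (Tnot (ne ∘ eqF-sound))

    maxBelowIn≤⁻ : ∀ f v L → maxBelowIn f L ≤ v → ∀ {q} → q ∈ L → T (isBelow q) → lookup f q ≤ v
    maxBelowIn≤⁻ f v (q ∷ L) h (here refl) bq =
      ≤-trans (subst (λ z → lookup f q ≤ (if z then lookup f q else 0)) (sym (T→≡ bq)) ≤-refl) (≤-trans (m≤m⊔n _ _) h)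
    maxBelowIn≤⁻ f v (q′ ∷ L) h (there m) bq = maxBelowIn≤⁻ f v L (≤-trans (m≤n⊔m _ _) h) m bq

    maxBelowIn≤⁺ : ∀ f v L → (∀ q → T (isBelow q) → lookup f q ≤ v) → maxBelowIn f L ≤ v
    maxBelowIn≤⁺ f v [] h = z≤n
    maxBelowIn≤⁺ f v (q ∷ L) h = ⊔-lub head≤ (maxBelowIn≤⁺ f v L h)
      where
      head≤ : (if isBelow q then lookup f q else 0) ≤ v
      head≤ with isBelow q in e
      ... | true = h q (≡→T e)
      ... | false = z≤n

    ≤minAboveIn⁻ : ∀ B f v L → v ≤ minAboveIn B f L → v ≤ B × (∀ {q} → q ∈ L → T (isAbove q) → v ≤ lookup f q)
    ≤minAboveIn⁻ B f v [] h = h , (λ ())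
    ≤minAboveIn⁻ B f v (q ∷ L) h with isAbove q in e
    ... | true = proj₁ rest , λ { (here refl) _ → ≤-trans h (m⊓n≤m _ _) ; (there m) a → proj₂ rest m a }
      where rest = ≤minAboveIn⁻ B f v L (≤-trans h (m⊓n≤n _ _))
    ... | false = proj₁ rest , λ { (here refl) a → ⊥-elim (subst T e a) ; (there m) a → proj₂ rest m a }
      where rest = ≤minAboveIn⁻ B f v L h

    ≤minAboveIn⁺ : ∀ B f v L → v ≤ B → (∀ q → T (isAbove q) → v ≤ lookup f q) → v ≤ minAboveIn B f L
    ≤minAboveIn⁺ B f v [] vB h = vB
    ≤minAboveIn⁺ B f v (q ∷ L) vB h with isAbove q in e
    ... | true = ⊓-glb (h q (≡→T e)) (≤minAboveIn⁺ B f v L vB h)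
    ... | false = ≤minAboveIn⁺ B f v L vB h

    maxBelowIn-update : ∀ g v L → maxBelowIn (g [ p ]≔ v) L ≡ maxBelowIn g L
    maxBelowIn-update g v [] = refl
    maxBelowIn-update g v (q ∷ L) with isBelow q in e
    ... | true = cong₂ _⊔_ (lookup∘updateAt′ q p (proj₂ (isBelow⁻ (≡→T e))) g) (maxBelowIn-update g v L)
    ... | false = cong (0 ⊔_) (maxBelowIn-update g v L)

    minAboveIn-update : ∀ B g v L → minAboveIn B (g [ p ]≔ v) L ≡ minAboveIn B g L
    minAboveIn-update B g v [] = refl
    minAboveIn-update B g v (q ∷ L) with isAbove q in e
    ... | true = cong₂ _⊓_ (lookup∘updateAt′ q p (proj₂ (isAbove⁻ (≡→T e))) g) (minAboveIn-update B g v L)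
    ... | false = minAboveIn-update B g v L

    isMonotoneOff : Vec ℕ n → Bool
    isMonotoneOff g = all (λ x → all (λ y → eqF P x p ∨ (eqF P y p ∨ (not (le P x y) ∨ (lookup g x ≤ᵇ lookup g y)))) (allFin n)) (allFin n)

    MonotoneOff : Vec ℕ n → Set
    MonotoneOff g = ∀ x y → x ≢ p → y ≢ p → x ≼ y → lookup g x ≤ lookup g y

    isMonotoneOff⁻ : ∀ g → T (isMonotoneOff g) → MonotoneOff g
    isMonotoneOff⁻ g h x y xp yp xy with T∨⁻ {eqF P x p} (all-allFin⁻ _ (all-allFin⁻ _ h x) y)
    ... | inj₁ a = ⊥-elim (xp (eqF-sound a))
    ... | inj₂ b with T∨⁻ {eqF P y p} b
    ...   | inj₁ a = ⊥-elim (yp (eqF-sound a))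
    ...   | inj₂ c with T∨⁻ {not (le P x y)} c
    ...     | inj₁ a = ⊥-elim (Tnot⁻ a (≼-complete xy))
    ...     | inj₂ d = ≤ᵇ⇒≤ _ _ d

    isMonotoneOff⁺ : ∀ g → MonotoneOff g → T (isMonotoneOff g)
    isMonotoneOff⁺ g h = all-allFin⁺ _ (λ x → all-allFin⁺ _ (λ y → pair x y))
      where
      pair : ∀ x y → T (eqF P x p ∨ (eqF P y p ∨ (not (le P x y) ∨ (lookup g x ≤ᵇ lookup g y))))
      pair x y with eqF P x p in e₁ | eqF P y p in e₂ | le P x y in e₃
      ... | true | _ | _ = tt
      ... | false | true | _ = tt
      ... | false | false | false = tt
      ... | false | false | true =
        ≤⇒≤ᵇ (h x y (λ q → subst T e₁ (eqF-complete q)) (λ q → subst T e₂ (eqF-complete q)) (≼-sound (≡→T e₃)))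

    hitsOff : Vec ℕ n → ℕ → Bool
    hitsOff g j = any (λ x → not (eqF P x p) ∧ (lookup g x ==ℕ j)) (allFin n)

    hitsOff⁻ : ∀ g j → T (hitsOff g j) → ∃ λ x → x ≢ p × lookup g x ≡ j
    hitsOff⁻ g j h with any-allFin⁻ _ h
    ... | x , t = x , (λ e → Tnot⁻ (T∧₁ t) (eqF-complete e)) , eqᵇ-sound _≟_ (T∧₂ {not (eqF P x p)} t)

    hitsOff⁺ : ∀ g j x → x ≢ p → lookup g x ≡ j → T (hitsOff g j)
    hitsOff⁺ g j x ne e = any-allFin⁺ (λ y → not (eqF P y p) ∧ (lookup g y ==ℕ j)) x
      (T∧ (Tnot (ne ∘ eqF-sound)) (subst (λ z → T (z ==ℕ j)) (sym e) (eqᵇ-refl _≟_ j)))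

    coveredWith : ℕ → Vec ℕ n → ℕ → Bool
    coveredWith r g v = allRange 1 r (λ j → (v ==ℕ j) ∨ hitsOff g j)

    updateCondition : ℕ → Vec ℕ n → ℕ → Bool
    updateCondition k g v = isMonotoneOff g ∧ ((maxBelow g ≤ᵇ v) ∧ ((v ≤ᵇ minAbove (suc k) g) ∧ coveredWith k g v))

    encodesChain-update⁻ : ∀ k g v → T (encodesChain k (g [ p ]≔ v)) → T (updateCondition k g v)
    encodesChain-update⁻ k g v h = T∧ (isMonotoneOff⁺ g monoOff) (T∧ (≤⇒≤ᵇ lower) (T∧ (≤⇒≤ᵇ upper) (allRange⁺ 1 k _ covered)))
      where
      f = g [ p ]≔ v
      f-at-p : lookup f p ≡ v
      f-at-p = lookup∘updateAt p g
      f-off-p : ∀ x → x ≢ p → lookup f x ≡ lookup g x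
      f-off-p x ne = lookup∘updateAt′ x p ne g
      mono = isMonotone⁻ f (T∧₁ (T∧₂ {boundedBy (suc k) f} h))
      f-hits = T∧₂ {isMonotone f} (T∧₂ {boundedBy (suc k) f} h)
      monoOff : MonotoneOff g
      monoOff x y xp yp xy = subst₂ _≤_ (f-off-p x xp) (f-off-p y yp) (mono x y xy)
      lower : maxBelow g ≤ v
      lower = maxBelowIn≤⁺ g v (allFin n)
        (λ q bq → subst₂ _≤_ (f-off-p q (proj₂ (isBelow⁻ bq))) f-at-p (mono q p (proj₁ (isBelow⁻ bq))))
      upper : v ≤ minAbove (suc k) g
      upper = ≤minAboveIn⁺ (suc k) g v (allFin n) (subst (_≤ suc k) f-at-p (boundedBy⁻ (suc k) f (T∧₁ h) p))
        (λ q aq → subst₂ _≤_ f-at-p (f-off-p q (proj₂ (isAbove⁻ aq))) (mono p q (proj₁ (isAbove⁻ aq))))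
      covered : ∀ j → 1 ≤ j → j < 1 + k → T ((v ==ℕ j) ∨ hitsOff g j)
      covered j 1≤j j≤k with hits⁻ f j (allRange⁻ 1 k (hits f) f-hits j 1≤j j≤k)
      ... | x , e with x Fin.≟ p
      ...   | yes refl = T∨₁ (subst (λ z → T (z ==ℕ j)) (trans (sym e) f-at-p) (eqᵇ-refl _≟_ j))
      ...   | no ne = T∨₂ {v ==ℕ j} (hitsOff⁺ g j x ne (trans (sym (f-off-p x ne)) e))

    encodesChain-update⁺ : ∀ k g v → T (boundedBy (suc k) g) → v ≤ suc k → T (updateCondition k g v) → T (encodesChain k (g [ p ]≔ v))
    encodesChain-update⁺ k g v bg vK h = T∧ (boundedBy⁺ (suc k) f bounded) (T∧ (isMonotone⁺ f mono) (allRange⁺ 1 k (hits f) f-hits))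
      where
      f = g [ p ]≔ v
      f-at-p : lookup f p ≡ v
      f-at-p = lookup∘updateAt p g
      f-off-p : ∀ x → x ≢ p → lookup f x ≡ lookup g x
      f-off-p x ne = lookup∘updateAt′ x p ne g
      monoOff = isMonotoneOff⁻ g (T∧₁ h)
      h₂ = T∧₂ {isMonotoneOff g} h
      lower = ≤ᵇ⇒≤ (maxBelow g) v (T∧₁ h₂)
      h₃ = T∧₂ {maxBelow g ≤ᵇ v} h₂
      upper = ≤ᵇ⇒≤ v (minAbove (suc k) g) (T∧₁ h₃)
      covered = T∧₂ {v ≤ᵇ minAbove (suc k) g} h₃
      bounded : ∀ x → lookup f x ≤ suc k
      bounded x with x Fin.≟ p
      ... | yes refl = subst (_≤ suc k) (sym f-at-p) vK
      ... | no ne = subst (_≤ suc k) (sym (f-off-p x ne)) (boundedBy⁻ (suc k) g bg x)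
      mono : Monotone f
      mono x y xy with x Fin.≟ p | y Fin.≟ p
      ... | yes refl | yes refl = ≤-refl
      ... | yes refl | no yp = subst₂ _≤_ (sym f-at-p) (sym (f-off-p y yp))
        (proj₂ (≤minAboveIn⁻ (suc k) g v (allFin n) upper) (∈-allFin y) (isAbove⁺ xy yp))
      ... | no xp | yes refl = subst₂ _≤_ (sym (f-off-p x xp)) (sym f-at-p)
        (maxBelowIn≤⁻ g v (allFin n) lower (∈-allFin x) (isBelow⁺ xy xp))
      ... | no xp | no yp = subst₂ _≤_ (sym (f-off-p x xp)) (sym (f-off-p y yp)) (monoOff x y xp yp xy)
      f-hits : ∀ j → 1 ≤ j → j < 1 + k → T (hits f j)
      f-hits j 1≤j j≤k with T∨⁻ {v ==ℕ j} (allRange⁻ 1 k _ covered j 1≤j j≤k)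
      ... | inj₁ a = subst (T ∘ hits f) (trans f-at-p (eqᵇ-sound _≟_ a)) (hits⁺ f p)
      ... | inj₂ b with hitsOff⁻ g j b
      ...   | x , ne , e = subst (T ∘ hits f) (trans (f-off-p x ne) e) (hits⁺ f x)

    encodesChain-update : ∀ k g v → T (boundedBy (suc k) g) → v ≤ suc k → encodesChain k (g [ p ]≔ v) ≡ updateCondition k g v
    encodesChain-update k g v bg vK = T⇔⇒≡ (encodesChain-update⁻ k g v) (encodesChain-update⁺ k g v bg vK)

    missing : ℕ → Vec ℕ n → List ℕ
    missing r g = filterᵇ (not ∘ hitsOff g) (interval 1 r)

    missing≡[]⇒hitsOff : ∀ r g → missing r g ≡ [] → ∀ j → 1 ≤ j → j < 1 + r → T (hitsOff g j)
    missing≡[]⇒hitsOff r g e j 1≤j j≤r with hitsOff g j in eh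
    ... | true = tt
    ... | false with subst (j ∈_) e (∈-filter-interval⁺ (not ∘ hitsOff g) 1 r j 1≤j j≤r (subst (T ∘ not) (sym eh) tt))
    ... | ()

    coveredWith-all : ∀ k g → missing k g ≡ [] → ∀ v → T (coveredWith k g v)
    coveredWith-all k g e v = allRange⁺ 1 k _ (λ j 1≤j j≤k → T∨₂ {v ==ℕ j} (missing≡[]⇒hitsOff k g e j 1≤j j≤k))

    coveredWith-forced : ∀ k g w → missing k g ≡ w ∷ [] → ∀ v → coveredWith k g v ≡ v ==ℕ w
    coveredWith-forced k g w e v = T⇔⇒≡ (λ h → forced (T∨⁻ {v ==ℕ w} (allRange⁻ 1 k _ h w (proj₁ w-missing) (proj₁ (proj₂ w-missing)))))
      (λ h → allRange⁺ 1 k _ (λ j 1≤j j≤k → covers j 1≤j j≤k (eqᵇ-sound _≟_ h)))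
      where
      w-missing = ∈-filter-interval⁻ (not ∘ hitsOff g) 1 k (subst (w ∈_) (sym e) (here refl))
      forced : T (v ==ℕ w) ⊎ T (hitsOff g w) → T (v ==ℕ w)
      forced (inj₁ a) = a
      forced (inj₂ b) = ⊥-elim (Tnot⁻ (proj₂ (proj₂ w-missing)) b)
      only : ∀ j → 1 ≤ j → j < 1 + k → ¬ T (hitsOff g j) → j ≡ w
      only j 1≤j j≤k nh with subst (j ∈_) e (∈-filter-interval⁺ (not ∘ hitsOff g) 1 k j 1≤j j≤k (Tnot nh))
      ... | here refl = refl
      covers : ∀ j → 1 ≤ j → j < 1 + k → v ≡ w → T ((v ==ℕ j) ∨ hitsOff g j)
      covers j 1≤j j≤k refl with hitsOff g j in eh
      ... | true = T∨₂ {v ==ℕ j} tt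
      ... | false = T∨₁ (subst (λ z → T (v ==ℕ z)) (sym (only j 1≤j j≤k (λ t → subst T eh t))) (eqᵇ-refl _≟_ v))

    coveredWith-none : ∀ k g a b r → missing k g ≡ a ∷ b ∷ r → ∀ v → ¬ T (coveredWith k g v)
    coveredWith-none k g a b r e v h =
      <-irrefl (trans (sym (forced a (∈-missing (here refl)))) (forced b (∈-missing (there (here refl)))))
        (filter-interval-sorted (not ∘ hitsOff g) 1 k a b r e)
      where
      ∈-missing : ∀ {j} → j ∈ a ∷ b ∷ r → 1 ≤ j × j < 1 + k × T (not (hitsOff g j))
      ∈-missing m = ∈-filter-interval⁻ (not ∘ hitsOff g) 1 k (subst (_ ∈_) (sym e) m)
      forced : ∀ j → 1 ≤ j × j < 1 + k × T (not (hitsOff g j)) → v ≡ j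
      forced j (1≤j , j≤k , nh) with T∨⁻ {v ==ℕ j} (allRange⁻ 1 k _ h j 1≤j j≤k)
      ... | inj₁ x = eqᵇ-sound _≟_ x
      ... | inj₂ y = ⊥-elim (Tnot⁻ nh y)

    sumRange-coveredWith : ∀ k g m M (Φ : ℕ → ℕ) →
      sumRange 0 (suc (suc k)) (λ v → 𝟙 ((m ≤ᵇ v) ∧ ((v ≤ᵇ M) ∧ coveredWith k g v)) * Φ v)
      ≡ 𝟙 (null (missing k g)) * sumRange 0 (suc (suc k)) (λ v → 𝟙 ((m ≤ᵇ v) ∧ (v ≤ᵇ M)) * Φ v)
        + onSingleton (missing k g) (λ w → 𝟙 ((m ≤ᵇ w) ∧ (w ≤ᵇ M)) * Φ w)
    sumRange-coveredWith k g m M Φ with missing k g in e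
    ... | [] = trans (sumRange-cong 0 (suc (suc k)) (λ v _ _ → cong (λ z → 𝟙 ((m ≤ᵇ v) ∧ ((v ≤ᵇ M) ∧ z)) * Φ v) (T→≡ (coveredWith-all k g e v))))
      (trans (sumRange-cong 0 (suc (suc k)) (λ v _ _ → cong (λ z → 𝟙 ((m ≤ᵇ v) ∧ z) * Φ v) (Bool.∧-identityʳ (v ≤ᵇ M))))
        (sym (trans (+-identityʳ _) (*-identityˡ _))))
    ... | w ∷ [] = trans (sumRange-cong 0 (suc (suc k)) (λ v _ _ → only-w v))
      (sumRange-pick (λ v → 𝟙 ((m ≤ᵇ v) ∧ (v ≤ᵇ M)) * Φ v) 0 (suc (suc k)) w z≤n (≤-trans w≤k (n≤1+n _)))
      where
      w≤k : w < suc k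
      w≤k = proj₁ (proj₂ (∈-filter-interval⁻ (not ∘ hitsOff g) 1 k (subst (w ∈_) (sym e) (here refl))))
      only-w : ∀ v → 𝟙 ((m ≤ᵇ v) ∧ ((v ≤ᵇ M) ∧ coveredWith k g v)) * Φ v ≡ 𝟙 (v ==ℕ w) * (𝟙 ((m ≤ᵇ v) ∧ (v ≤ᵇ M)) * Φ v)
      only-w v rewrite coveredWith-forced k g w e v with v ==ℕ w
      ... | true rewrite Bool.∧-identityʳ (v ≤ᵇ M) = sym (+-identityʳ _)
      ... | false rewrite Bool.∧-zeroʳ (v ≤ᵇ M) | Bool.∧-zeroʳ (m ≤ᵇ v) = refl
    ... | a ∷ b ∷ r = sumRange-zero _ 0 (suc (suc k))
      (λ v _ _ → cong (_* Φ v) (𝟙-¬T (λ h → coveredWith-none k g a b r e v (T∧₂ {v ≤ᵇ M} (T∧₂ {m ≤ᵇ v} h)))))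

    fiberBase : Vec ℕ n → Bool
    fiberBase g = (lookup g p ==ℕ 0) ∧ isMonotoneOff g

    compressedBase : ℕ → Vec ℕ n → Bool
    compressedBase k g = (lookup g p ==ℕ 0) ∧ (isMonotoneOff g ∧ null (missing k g))

    punchIn-base : ∀ k h w → 1 ≤ w → w ≤ suc k → T (compressedBase k h) →
      T (fiberBase (Vec.map (punchIn w) h)) × missing (suc k) (Vec.map (punchIn w) h) ≡ w ∷ []
    punchIn-base k h w 1≤w w≤k base = T∧ (eqᵇ-complete _≟_ g-at-p) (isMonotoneOff⁺ g monoOff) , missing-w
      where
      g = Vec.map (punchIn w) h
      lookup-g : ∀ x → lookup g x ≡ punchIn w (lookup h x)
      lookup-g x = lookup-map x (punchIn w) h
      h-at-p : lookup h p ≡ 0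
      h-at-p = eqᵇ-sound _≟_ (T∧₁ base)
      h-monoOff = isMonotoneOff⁻ h (T∧₁ (T∧₂ {lookup h p ==ℕ 0} base))
      h-missing : missing k h ≡ []
      h-missing = null-sound _ (T∧₂ {isMonotoneOff h} (T∧₂ {lookup h p ==ℕ 0} base))
      g-at-p : lookup g p ≡ 0
      g-at-p = trans (lookup-g p) (trans (cong (punchIn w) h-at-p) (punchIn-< w 0 1≤w))
      monoOff : MonotoneOff g
      monoOff x y xp yp xy = subst₂ _≤_ (sym (lookup-g x)) (sym (lookup-g y)) (punchIn-mono w (h-monoOff x y xp yp xy))
      w-missed : T (not (hitsOff g w))
      w-missed = Tnot (λ ht → let (x , _ , e) = hitsOff⁻ g w ht in punchIn-≢ w (lookup h x) (trans (sym (lookup-g x)) e))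
      hit-from-h : ∀ j i → 1 ≤ i → i < 1 + k → punchIn w i ≡ j → T (hitsOff g j)
      hit-from-h j i 1≤i i≤k e = let (x , xp , hx) = hitsOff⁻ h i (missing≡[]⇒hitsOff k h h-missing i 1≤i i≤k)
                                 in hitsOff⁺ g j x xp (trans (lookup-g x) (trans (cong (punchIn w) hx) e))
      only-w : ∀ j → 1 ≤ j → j < 1 + suc k → T (not (hitsOff g j)) → j ≡ w
      only-w j 1≤j j≤k q with j ≟ w | j <? w
      ... | yes e | _ = e
      ... | no _ | yes j<w = ⊥-elim (Tnot⁻ q (hit-from-h j j 1≤j (<-≤-trans j<w w≤k) (punchIn-< w j j<w)))
      ... | no j≢w | no j≮w with j | ≤∧≢⇒< (≮⇒≥ j≮w) (j≢w ∘ sym) | j≤k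
      ...   | suc j′ | s≤s w≤j′ | s≤s j′≤k = ⊥-elim (Tnot⁻ q (hit-from-h (suc j′) j′ (≤-trans 1≤w w≤j′) j′≤k (punchIn-≥ w j′ w≤j′)))
      missing-w : missing (suc k) g ≡ w ∷ []
      missing-w = filter-interval-single (not ∘ hitsOff g) 1 (suc k) w 1≤w (s≤s w≤k) only-w w-missed

    punchOut-base : ∀ k g w → 1 ≤ w → T (fiberBase g) → missing (suc k) g ≡ w ∷ [] →
      T (compressedBase k (Vec.map (punchOut w) g)) × Vec.map (punchIn w) (Vec.map (punchOut w) g) ≡ g
    punchOut-base k g w 1≤w base g-missing = T∧ (eqᵇ-complete _≟_ h-at-p) (T∧ (isMonotoneOff⁺ h monoOff) (subst (T ∘ null) (sym h-missing) tt)) , inverse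
      where
      h = Vec.map (punchOut w) g
      lookup-h : ∀ x → lookup h x ≡ punchOut w (lookup g x)
      lookup-h x = lookup-map x (punchOut w) g
      g-at-p : lookup g p ≡ 0
      g-at-p = eqᵇ-sound _≟_ (T∧₁ base)
      g-monoOff = isMonotoneOff⁻ g (T∧₂ {lookup g p ==ℕ 0} base)
      w-missing = ∈-filter-interval⁻ (not ∘ hitsOff g) 1 (suc k) (subst (w ∈_) (sym g-missing) (here refl))
      g-hits : ∀ j → 1 ≤ j → j < 2 + k → j ≢ w → T (hitsOff g j)
      g-hits j 1≤j j≤k j≢w with hitsOff g j in e
      ... | true = tt
      ... | false with subst (j ∈_) g-missing (∈-filter-interval⁺ (not ∘ hitsOff g) 1 (suc k) j 1≤j j≤k (subst (T ∘ not) (sym e) tt))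
      ...   | here j≡w = ⊥-elim (j≢w j≡w)
      h-at-p : lookup h p ≡ 0
      h-at-p = trans (lookup-h p) (trans (cong (punchOut w) g-at-p) (punchOut-< w 0 1≤w))
      monoOff : MonotoneOff h
      monoOff x y xp yp xy = subst₂ _≤_ (sym (lookup-h x)) (sym (lookup-h y)) (punchOut-mono w (g-monoOff x y xp yp xy))
      hit-from-g : ∀ j i → 1 ≤ i → i < 2 + k → i ≢ w → punchOut w i ≡ j → T (hitsOff h j)
      hit-from-g j i 1≤i i≤k i≢w e = let (x , xp , gx) = hitsOff⁻ g i (g-hits i 1≤i i≤k i≢w)
                                    in hitsOff⁺ h j x xp (trans (lookup-h x) (trans (cong (punchOut w) gx) e))
      h-hits : ∀ j → 1 ≤ j → j < 1 + k → T (hitsOff h j)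
      h-hits j 1≤j j≤k with j <? w
      ... | yes j<w = hit-from-g j j 1≤j (≤-trans j≤k (n≤1+n _)) (λ e → <-irrefl e j<w) (punchOut-< w j j<w)
      ... | no j≮w = hit-from-g j (suc j) (s≤s z≤n) (s≤s j≤k) (λ e → j≮w (subst (j <_) e (n<1+n j)))
                       (punchOut-≥ w (suc j) (m≤n⇒m≤1+n (≮⇒≥ j≮w)))
      h-missing : missing k h ≡ []
      h-missing = filter-interval-none (not ∘ hitsOff h) 1 k (λ j 1≤j j≤k q → Tnot⁻ q (h-hits j 1≤j j≤k))
      g≢w : ∀ x → lookup g x ≢ w
      g≢w x e with x Fin.≟ p
      ... | yes refl = <-irrefl (trans (sym g-at-p) e) 1≤w
      ... | no xp = Tnot⁻ (proj₂ (proj₂ w-missing)) (hitsOff⁺ g w x xp e)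
      inverse : Vec.map (punchIn w) h ≡ g
      inverse = lookup-ext _ _ (λ x → trans (lookup-map x (punchIn w) h)
        (trans (cong (punchIn w) (lookup-h x)) (punchIn-punchOut w (lookup g x) (g≢w x))))

    punchIn-correspondence : ∀ k g h w → 1 ≤ w → w ≤ suc k →
      (compressedBase k h ∧ (g ==ᵛ Vec.map (punchIn w) h))
        ≡ (fiberBase g ∧ (isSingletonOf (missing (suc k) g) w ∧ (h ==ᵛ Vec.map (punchOut w) g)))
    punchIn-correspondence k g h w 1≤w w≤k = T⇔⇒≡ fwd bwd
      where
      fwd : T (compressedBase k h ∧ (g ==ᵛ Vec.map (punchIn w) h)) →
            T (fiberBase g ∧ (isSingletonOf (missing (suc k) g) w ∧ (h ==ᵛ Vec.map (punchOut w) g)))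
      fwd t = subst (λ g → T (fiberBase g ∧ (isSingletonOf (missing (suc k) g) w ∧ (h ==ᵛ Vec.map (punchOut w) g))))
        (sym (eqᵇ-sound (≡-dec _≟_) (T∧₂ {compressedBase k h} t)))
        (T∧ (proj₁ image) (T∧ (subst (λ z → T (isSingletonOf z w)) (sym (proj₂ image)) (eqᵇ-refl _≟_ w))
          (eqᵇ-complete (≡-dec _≟_) (sym (lookup-ext _ _ (λ x → trans (lookup-map x (punchOut w) (Vec.map (punchIn w) h))
            (trans (cong (punchOut w) (lookup-map x (punchIn w) h)) (punchOut-punchIn w (lookup h x)))))))))
        where image = punchIn-base k h w 1≤w w≤k (T∧₁ t)
      bwd : T (fiberBase g ∧ (isSingletonOf (missing (suc k) g) w ∧ (h ==ᵛ Vec.map (punchOut w) g))) →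
            T (compressedBase k h ∧ (g ==ᵛ Vec.map (punchIn w) h))
      bwd t = subst (λ h → T (compressedBase k h ∧ (g ==ᵛ Vec.map (punchIn w) h))) (sym h≡)
          (T∧ (proj₁ preimage) (eqᵇ-complete (≡-dec _≟_) (sym (proj₂ preimage))))
        where
        t₂ = T∧₂ {fiberBase g} t
        h≡ = eqᵇ-sound (≡-dec _≟_) (T∧₂ {isSingletonOf (missing (suc k) g) w} t₂)
        preimage = punchOut-base k g w 1≤w (T∧₁ t) (isSingletonOf-sound _ w (T∧₁ t₂))

    sumBounded-punchOut-fiber : ∀ k (Φ : Vec ℕ n → ℕ → ℕ) g → T (boundedBy (suc (suc k)) g) →
      sumBounded n (suc k) (λ h → sumRange 1 (suc k) (λ w →
        𝟙 (fiberBase g ∧ (isSingletonOf (missing (suc k) g) w ∧ (h ==ᵛ Vec.map (punchOut w) g))) * Φ g w))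
      ≡ 𝟙 (fiberBase g) * onSingleton (missing (suc k) g) (Φ g)
    sumBounded-punchOut-fiber k Φ g bg = begin
      sumBounded n K (λ h → sumRange 1 K (λ w → 𝟙 (fiberBase g ∧ (single w ∧ (h ==ᵛ out w))) * Φ g w))
        ≡⟨ sumBounded-swapRange n K _ 1 K ⟩
      sumRange 1 K (λ w → sumBounded n K (λ h → 𝟙 (fiberBase g ∧ (single w ∧ (h ==ᵛ out w))) * Φ g w))
        ≡⟨ sumRange-cong 1 K (λ w _ w≤K → trans (sumBounded-cong n K (λ h _ → cong (λ z → 𝟙 z * Φ g w) (sym (Bool.∧-assoc (fiberBase g) _ _))))
                                              (sumBounded-pick-∧ n K (fiberBase g ∧ single w) (λ _ → Φ g w) (out w) (out-bounded w (≤-pred w≤K)))) ⟩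
      sumRange 1 K (λ w → 𝟙 (fiberBase g ∧ single w) * Φ g w)
        ≡⟨ pick-missing ⟩
      𝟙 (fiberBase g) * onSingleton (missing K g) (Φ g) ∎
      where
      open ≡-Reasoning
      K = suc k
      single : ℕ → Bool
      single w = isSingletonOf (missing K g) w
      out : ℕ → Vec ℕ n
      out w = Vec.map (punchOut w) g
      out-bounded : ∀ w → w ≤ K → T (boundedBy K (out w))
      out-bounded w w≤K = boundedBy⁺ K (out w)
        (λ x → subst (_≤ K) (sym (lookup-map x (punchOut w) g)) (punchOut-≤ K w (lookup g x) w≤K (boundedBy⁻ (suc K) g bg x)))
      none : ∀ w → 𝟙 (fiberBase g ∧ false) * Φ g w ≡ 0
      none w = cong (λ z → 𝟙 z * Φ g w) (Bool.∧-zeroʳ (fiberBase g))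
      pick-missing : sumRange 1 K (λ w → 𝟙 (fiberBase g ∧ single w) * Φ g w) ≡ 𝟙 (fiberBase g) * onSingleton (missing K g) (Φ g)
      pick-missing with missing K g in e
      ... | [] = trans (sumRange-zero _ 1 K (λ w _ _ → none w)) (sym (*-zeroʳ (𝟙 (fiberBase g))))
      ... | a ∷ b ∷ r = trans (sumRange-zero _ 1 K (λ w _ _ → none w)) (sym (*-zeroʳ (𝟙 (fiberBase g))))
      ... | w₀ ∷ [] = trans (sumRange-cong 1 K (λ w _ _ → select w))
        (sumRange-pick (λ w → 𝟙 (fiberBase g) * Φ g w) 1 K w₀ (proj₁ w₀-range) (proj₁ (proj₂ w₀-range)))
        where
        w₀-range = ∈-filter-interval⁻ (not ∘ hitsOff g) 1 K (subst (w₀ ∈_) (sym e) (here refl))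
        select : ∀ w → 𝟙 (fiberBase g ∧ (w ==ℕ w₀)) * Φ g w ≡ 𝟙 (w ==ℕ w₀) * (𝟙 (fiberBase g) * Φ g w)
        select w with w ==ℕ w₀
        ... | true rewrite Bool.∧-identityʳ (fiberBase g) = sym (+-identityʳ _)
        ... | false = none w

    -- g ↦ (w, g with the value w deleted) is a bijection from the fibre bases missing exactly one value w
    -- onto the pairs (w, h) with h a fibre base missing no value.
    sumBounded-punchIn : ∀ k (Φ : Vec ℕ n → ℕ → ℕ) →
      sumBounded n (suc (suc k)) (λ g → 𝟙 (fiberBase g) * onSingleton (missing (suc k) g) (Φ g))
      ≡ sumBounded n (suc k) (λ h → 𝟙 (compressedBase k h) * sumRange 1 (suc k) (λ w → Φ (Vec.map (punchIn w) h) w))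
    sumBounded-punchIn k Φ = sym (begin
      sumBounded n K (λ h → 𝟙 (compressedBase k h) * sumRange 1 K (λ w → Φ (ins w h) w))
        ≡⟨ sumBounded-cong n K (λ h _ → sym (sumRange-*ˡ (𝟙 (compressedBase k h)) (λ w → Φ (ins w h) w) 1 K)) ⟩
      sumBounded n K (λ h → sumRange 1 K (λ w → 𝟙 (compressedBase k h) * Φ (ins w h) w))
        ≡⟨ sumBounded-cong n K (λ h bh → sumRange-cong 1 K (λ w _ w≤K →
             sym (sumBounded-pick-∧ n (suc K) (compressedBase k h) (λ g → Φ g w) (ins w h) (ins-bounded h bh w)))) ⟩
      sumBounded n K (λ h → sumRange 1 K (λ w → sumBounded n (suc K) (λ g → 𝟙 (compressedBase k h ∧ (g ==ᵛ ins w h)) * Φ g w)))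
        ≡⟨ sumBounded-cong n K (λ h _ → sym (sumBounded-swapRange n (suc K) (λ g w → 𝟙 (compressedBase k h ∧ (g ==ᵛ ins w h)) * Φ g w) 1 K)) ⟩
      sumBounded n K (λ h → sumBounded n (suc K) (λ g → sumRange 1 K (λ w → 𝟙 (compressedBase k h ∧ (g ==ᵛ ins w h)) * Φ g w)))
        ≡⟨ sumBounded-swap n K n (suc K) (λ h g → sumRange 1 K (λ w → 𝟙 (compressedBase k h ∧ (g ==ᵛ ins w h)) * Φ g w)) ⟩
      sumBounded n (suc K) (λ g → sumBounded n K (λ h → sumRange 1 K (λ w → 𝟙 (compressedBase k h ∧ (g ==ᵛ ins w h)) * Φ g w)))
        ≡⟨ sumBounded-cong n (suc K) (λ g _ → sumBounded-cong n K (λ h _ → sumRange-cong 1 K (λ w 1≤w w≤K →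
             cong (λ z → 𝟙 z * Φ g w) (punchIn-correspondence k g h w 1≤w (≤-pred w≤K))))) ⟩
      sumBounded n (suc K) (λ g → sumBounded n K (λ h → sumRange 1 K (λ w →
        𝟙 (fiberBase g ∧ (isSingletonOf (missing K g) w ∧ (h ==ᵛ Vec.map (punchOut w) g))) * Φ g w)))
        ≡⟨ sumBounded-cong n (suc K) (λ g bg → sumBounded-punchOut-fiber k Φ g bg) ⟩
      sumBounded n (suc K) (λ g → 𝟙 (fiberBase g) * onSingleton (missing K g) (Φ g)) ∎)
      where
      open ≡-Reasoning
      K = suc k
      ins : ℕ → Vec ℕ n → Vec ℕ n
      ins w = Vec.map (punchIn w)
      ins-bounded : ∀ h → T (boundedBy K h) → ∀ w → T (boundedBy (suc K) (ins w h))
      ins-bounded h bh w = boundedBy⁺ (suc K) (ins w h)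
        (λ x → subst (_≤ suc K) (sym (lookup-map x (punchIn w) h)) (punchIn-≤ K w (lookup h x) (boundedBy⁻ K h bh x)))

    maxBelowIn-punchIn : ∀ w h → 1 ≤ w → ∀ L → maxBelowIn (Vec.map (punchIn w) h) L ≡ punchIn w (maxBelowIn h L)
    maxBelowIn-punchIn w h 1≤w [] = sym (punchIn-< w 0 1≤w)
    maxBelowIn-punchIn w h 1≤w (q ∷ L)
      rewrite punchIn-⊔ w (if isBelow q then lookup h q else 0) (maxBelowIn h L) | maxBelowIn-punchIn w h 1≤w L with isBelow q
    ... | true = cong (_⊔ punchIn w (maxBelowIn h L)) (lookup-map q (punchIn w) h)
    ... | false = cong (_⊔ punchIn w (maxBelowIn h L)) (sym (punchIn-< w 0 1≤w))

    minAboveIn-punchIn : ∀ k w h → w ≤ k → ∀ L → minAboveIn (suc k) (Vec.map (punchIn w) h) L ≡ punchIn w (minAboveIn k h L)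
    minAboveIn-punchIn k w h w≤k [] = sym (punchIn-≥ w k w≤k)
    minAboveIn-punchIn k w h w≤k (q ∷ L) with isAbove q
    ... | true = trans (cong₂ _⊓_ (lookup-map q (punchIn w) h) (minAboveIn-punchIn k w h w≤k L))
                       (sym (punchIn-⊓ w (lookup h q) (minAboveIn k h L)))
    ... | false = minAboveIn-punchIn k w h w≤k L

    windowTerm : ℕ → (ℕ → ℕ → ℕ → ℕ) → Vec ℕ n → ℕ → ℕ
    windowTerm k Wt g w = 𝟙 ((maxBelow g ≤ᵇ w) ∧ (w ≤ᵇ minAbove (suc k) g)) * Wt (maxBelow g) (minAbove (suc k) g) w

    windowSum : ℕ → (ℕ → ℕ → ℕ → ℕ) → Vec ℕ n → ℕ
    windowSum k Wt g = sumRange 0 (suc (suc k)) (windowTerm k Wt g)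

    -- Fixing f away from p, either every value 1, …, k is attained there and f(p) ranges over a whole
    -- window, or exactly one value w is missed there and f(p) = w is forced.
    sumBounded-encodesChain-fibers : ∀ k (Wt : ℕ → ℕ → ℕ → ℕ) →
      sumBounded n (suc k) (λ f → 𝟙 (encodesChain k f) * Wt (maxBelow f) (minAbove (suc k) f) (lookup f p))
      ≡ sumBounded n (suc k) (λ g → 𝟙 (lookup g p ==ℕ 0) * (𝟙 (isMonotoneOff g)
          * (𝟙 (null (missing k g)) * windowSum k Wt g + onSingleton (missing k g) (windowTerm k Wt g))))
    sumBounded-encodesChain-fibers k Wt = trans (sumBounded-fiber n (suc k) p _)
      (sumBounded-cong n (suc k) (λ g bg → cong (𝟙 (lookup g p ==ℕ 0) *_) (fiber g bg)))
      where
      K = suc k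
      fiber : ∀ g → T (boundedBy K g) →
        sumRange 0 (suc K) (λ v → 𝟙 (encodesChain k (g [ p ]≔ v)) * Wt (maxBelow (g [ p ]≔ v)) (minAbove K (g [ p ]≔ v)) (lookup (g [ p ]≔ v) p))
        ≡ 𝟙 (isMonotoneOff g) * (𝟙 (null (missing k g)) * windowSum k Wt g + onSingleton (missing k g) (windowTerm k Wt g))
      fiber g bg = trans (sumRange-cong 0 (suc K) (λ v _ v≤K → pointwise v (≤-pred v≤K)))
        (trans (sumRange-*ˡ (𝟙 (isMonotoneOff g)) _ 0 (suc K))
          (cong (𝟙 (isMonotoneOff g) *_) (sumRange-coveredWith k g (maxBelow g) (minAbove K g) (Wt (maxBelow g) (minAbove K g)))))
        where
        pointwise : ∀ v → v ≤ K →
          𝟙 (encodesChain k (g [ p ]≔ v)) * Wt (maxBelow (g [ p ]≔ v)) (minAbove K (g [ p ]≔ v)) (lookup (g [ p ]≔ v) p)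
          ≡ 𝟙 (isMonotoneOff g) * (𝟙 ((maxBelow g ≤ᵇ v) ∧ ((v ≤ᵇ minAbove K g) ∧ coveredWith k g v)) * Wt (maxBelow g) (minAbove K g) v)
        pointwise v v≤K rewrite encodesChain-update k g v bg v≤K | maxBelowIn-update g v (allFin n) | minAboveIn-update K g v (allFin n)
                               | lookup∘updateAt p {const v} g =
          𝟙-∧-* (isMonotoneOff g) ((maxBelow g ≤ᵇ v) ∧ ((v ≤ᵇ minAbove K g) ∧ coveredWith k g v)) (Wt (maxBelow g) (minAbove K g) v)

    gapBelow gapAbove : ℕ → ℕ → ℕ → ℕ
    gapBelow m M v = v ∸ m
    gapAbove m M v = M ∸ v

    windowSum-balance : ∀ k g → windowSum k gapBelow g ≡ windowSum k gapAbove g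
    windowSum-balance k g = window-balance (maxBelow g) (minAbove (suc k) g) (suc (suc k)) (s≤s (minAboveIn≤ (suc k) g (allFin n)))

    -- After compressing the missed value w away, w runs over the window (maxBelow h, minAbove h]
    -- with weights w ∸ maxBelow h and minAbove h + 1 ∸ w, which again balance.
    forced-balance : ∀ k →
      sumBounded n (suc k) (λ g → 𝟙 (fiberBase g) * onSingleton (missing k g) (windowTerm k gapBelow g))
      ≡ sumBounded n (suc k) (λ g → 𝟙 (fiberBase g) * onSingleton (missing k g) (windowTerm k gapAbove g))
    forced-balance zero = refl
    forced-balance (suc k) = begin
      sumBounded n (suc (suc k)) (λ g → 𝟙 (fiberBase g) * onSingleton (missing (suc k) g) (windowTerm (suc k) gapBelow g))
        ≡⟨ sumBounded-punchIn k (windowTerm (suc k) gapBelow) ⟩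
      sumBounded n (suc k) (λ h → 𝟙 (compressedBase k h) * sumRange 1 (suc k) (λ w → windowTerm (suc k) gapBelow (ins w h) w))
        ≡⟨ sumBounded-cong n (suc k) (λ h _ → cong (𝟙 (compressedBase k h) *_) (balanced h)) ⟩
      sumBounded n (suc k) (λ h → 𝟙 (compressedBase k h) * sumRange 1 (suc k) (λ w → windowTerm (suc k) gapAbove (ins w h) w))
        ≡⟨ sumBounded-punchIn k (windowTerm (suc k) gapAbove) ⟨
      sumBounded n (suc (suc k)) (λ g → 𝟙 (fiberBase g) * onSingleton (missing (suc k) g) (windowTerm (suc k) gapAbove g)) ∎
      where
      open ≡-Reasoning
      ins : ℕ → Vec ℕ n → Vec ℕ n
      ins w = Vec.map (punchIn w)
      balanced : ∀ h → sumRange 1 (suc k) (λ w → windowTerm (suc k) gapBelow (ins w h) w)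
                     ≡ sumRange 1 (suc k) (λ w → windowTerm (suc k) gapAbove (ins w h) w)
      balanced h = trans (sumRange-cong 1 (suc k) (λ w 1≤w w≤k → below w 1≤w (≤-pred w≤k)))
        (trans (window-balance-open (maxBelow h) (minAbove (suc k) h) (suc k) (minAboveIn≤ (suc k) h (allFin n)))
          (sym (sumRange-cong 1 (suc k) (λ w 1≤w w≤k → above w 1≤w (≤-pred w≤k)))))
        where
        below : ∀ w → 1 ≤ w → w ≤ suc k → windowTerm (suc k) gapBelow (ins w h) w
          ≡ 𝟙 ((suc (maxBelow h) ≤ᵇ w) ∧ (w ≤ᵇ minAbove (suc k) h)) * (w ∸ maxBelow h)
        below w 1≤w w≤k rewrite maxBelowIn-punchIn w h 1≤w (allFin n) | minAboveIn-punchIn (suc k) w h w≤k (allFin n) =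
          punchIn-window-below w (maxBelow h) (minAbove (suc k) h)
        above : ∀ w → 1 ≤ w → w ≤ suc k → windowTerm (suc k) gapAbove (ins w h) w
          ≡ 𝟙 ((suc (maxBelow h) ≤ᵇ w) ∧ (w ≤ᵇ minAbove (suc k) h)) * (suc (minAbove (suc k) h) ∸ w)
        above w 1≤w w≤k rewrite maxBelowIn-punchIn w h 1≤w (allFin n) | minAboveIn-punchIn (suc k) w h w≤k (allFin n) =
          punchIn-window-above w (maxBelow h) (minAbove (suc k) h)

    toggle-balance : ∀ k →
      sumBounded n (suc k) (λ f → 𝟙 (encodesChain k f) * (lookup f p ∸ maxBelow f))
      ≡ sumBounded n (suc k) (λ f → 𝟙 (encodesChain k f) * (minAbove (suc k) f ∸ lookup f p))
    toggle-balance k = begin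
      sumBounded n K (λ f → 𝟙 (encodesChain k f) * (lookup f p ∸ maxBelow f))
        ≡⟨ sumBounded-encodesChain-fibers k gapBelow ⟩
      sumBounded n K (fibers gapBelow)
        ≡⟨ split gapBelow ⟩
      sumBounded n K (whole gapBelow) + sumBounded n K (forced gapBelow)
        ≡⟨ cong₂ _+_ (sumBounded-cong n K (λ g _ → cong (λ z → 𝟙 (at-p g) * (𝟙 (isMonotoneOff g) * (𝟙 (null (missing k g)) * z)))
                                                     (windowSum-balance k g)))
                     (forced-balance k) ⟩
      sumBounded n K (whole gapAbove) + sumBounded n K (forced gapAbove)
        ≡⟨ split gapAbove ⟨
      sumBounded n K (fibers gapAbove)
        ≡⟨ sumBounded-encodesChain-fibers k gapAbove ⟨
      sumBounded n K (λ f → 𝟙 (encodesChain k f) * (minAbove K f ∸ lookup f p)) ∎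
      where
      open ≡-Reasoning
      K = suc k
      at-p : Vec ℕ n → Bool
      at-p g = lookup g p ==ℕ 0
      fibers whole forced : (ℕ → ℕ → ℕ → ℕ) → Vec ℕ n → ℕ
      fibers Wt g = 𝟙 (at-p g) * (𝟙 (isMonotoneOff g) * (𝟙 (null (missing k g)) * windowSum k Wt g + onSingleton (missing k g) (windowTerm k Wt g)))
      whole Wt g = 𝟙 (at-p g) * (𝟙 (isMonotoneOff g) * (𝟙 (null (missing k g)) * windowSum k Wt g))
      forced Wt g = 𝟙 (fiberBase g) * onSingleton (missing k g) (windowTerm k Wt g)
      distribute : ∀ a b N A S → 𝟙 a * (𝟙 b * (N * A + S)) ≡ 𝟙 a * (𝟙 b * (N * A)) + 𝟙 (a ∧ b) * S
      distribute a b N A S = trans (cong (𝟙 a *_) (*-distribˡ-+ (𝟙 b) (N * A) S))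
        (trans (*-distribˡ-+ (𝟙 a) _ _) (cong (𝟙 a * (𝟙 b * (N * A)) +_) (sym (𝟙-∧-* a b S))))
      split : ∀ Wt → sumBounded n K (fibers Wt) ≡ sumBounded n K (whole Wt) + sumBounded n K (forced Wt)
      split Wt = trans (sumBounded-cong n K (λ g _ → distribute (at-p g) (isMonotoneOff g) (𝟙 (null (missing k g)))
                                                       (windowSum k Wt g) (onSingleton (missing k g) (windowTerm k Wt g))))
                       (sumBounded-+ n K (whole Wt) (forced Wt))

    chainTotal-toggle-balance : ∀ k → chainTotal k (togglePlus P p) ≡ chainTotal k (toggleMinus P p)
    chainTotal-toggle-balance k = trans (chainTotal-togglePlus k) (trans (toggle-balance k) (sym (chainTotal-toggleMinus k)))

lemma2p4 : (P : FinPoset) → (k : ℕ) → k ≤ FinPoset.n P → ToggleSymmetric P (chainDist P k)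
lemma2p4 P k _ p = begin
  expect P (chainDist P k) (togglePlus P p)        ≡⟨ expect-chainDist P k (togglePlus P p) ⟩
  frac P (chainTotal P k (togglePlus P p)) total   ≡⟨ cong (λ z → frac P z total) (chainTotal-toggle-balance P p k) ⟩
  frac P (chainTotal P k (toggleMinus P p)) total  ≡⟨ expect-chainDist P k (toggleMinus P p) ⟨
  expect P (chainDist P k) (toggleMinus P p)       ∎
  where
  open ≡-Reasoning
  total = suc k * length (chains P k)
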